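{- Let $P$ be a hull configuration whose convex hull is a convex $k$-gon ($k\ge3$), with sides numbered $1,\dots,k$ counterclockwise so that side $1$ is blank, and with points labeled $z_{i,j}$ and elements $\alpha_{ij},\beta_{ij}$ as in the context. Let $X\subseteq\textsc{NC}(P)$ be the subposet of all noncrossing partitions in which $z_{1,0}$ is either a singleton block or lies in the same block as $z_{k,c_k}$. Then $X\cong\textsc{NC}(P\setminus\{z_{1,0}\})\times\textsc{Bool}(1)$, and $\textsc{NC}(P)$ is the disjoint union of $X$ and the intervals $[\alpha_{ij},\beta_{ij}]$ for $2\le i\le k-1$ and $0\le j\le c_i$.
   Context: A hull configuration is a finite set $P$ of points in the plane such that either $\textsc{Conv}(P)$ is one-dimensional or no point of $P$ lies in the interior of $\textsc{Conv}(P)$. For a finite point set $S$, a set partition of $S$ is noncrossing if the convex hulls of its blocks are pairwise disjoint, and $\textsc{NC}(S)$ is the poset of noncrossing partitions of $S$ ordered by refinement. $\textsc{Bool}(1)$ is the two-element chain. Labeling: if $\textsc{Conv}(P)$ is a $k$-gon, number its sides $1,\dots,k$ counterclockwise and let $c_i$ be the number of points of $P$ in the relative interior of side $i$; side $i$ is blank if $c_i=0$. The $c_i+2$ points of $P$ on side $i$ are labeled $z_{i,0},z_{i,1},\dots,z_{i,c_i},z_{i+1,0}$ in counterclockwise order, first index mod $k$. Here $c_1=0$, and $z_{k,c_k}$ is the point immediately preceding $z_{1,0}$ in counterclockwise order. For $2\le i\le k-1$, $0\le j\le c_i$: $\alpha_{ij}$ is the element of $\textsc{NC}(P)$ whose only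 non-singleton block is $\{z_{1,0},z_{i,j}\}$, and $\beta_{ij}$ is the element of $\textsc{NC}(P)$ with exactly two blocks, one consisting of all points from $z_{1,0}$ to $z_{i,j}$ in counterclockwise order around the boundary of $\textsc{Conv}(P)$ and the other consisting of all remaining points. Intervals are $[\alpha,\beta]=\{\pi\in\textsc{NC}(P):\alpha\le\pi\le\beta\}$. -}

module Defs where

open import Level using (0ℓ)
open import Algebra.Bundles using (CommutativeRing)
open import Relation.Binary using (Rel; IsStrictTotalOrder)
open import Relation.Binary.PropositionalEquality using (_≡_; _≢_)
open import Relation.Nullary using (¬_)
open import Data.Nat using (ℕ; zero; suc; _≤_; _<_; _≡ᵇ_; _<ᵇ_; _≤ᵇ_; s≤s; z≤n)
open import Data.Nat.Properties using (≤-trans; ≤-refl)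
open import Data.Bool using (Bool; true; false; _∧_; _∨_; _xor_; not; if_then_else_)
open import Data.Fin using (Fin)
import Data.Fin as Fin
open import Data.Product using (Σ; ∃; _×_; _,_; proj₁; proj₂)
open import Data.Sum using (_⊎_)

-- Ordered fields (the plane is F × F for an ordered field F; ℝ is one).

record OrderedField : Set₁ where
  field
    commRing : CommutativeRing 0ℓ 0ℓ
  open CommutativeRing commRing public
  infix 4 _<F_
  field
    _<F_                : Rel Carrier 0ℓ
    <F-isStrictTotalOrder : IsStrictTotalOrder _≈_ _<F_
    +-monoʳ-<F          : ∀ {a b} c → a <F b → (a + c) <F (b + c)
    *-pos               : ∀ {a b} → 0# <F a → 0# <F b → 0# <F (a * b)
    0<F1                : 0# <F 1#
    inverse             : ∀ a → ¬ (a ≈ 0#) → ∃ λ b → (a * b) ≈ 1#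

record Partition (I : Set) : Set where
  field
    rel       : I → I → Bool
    rel-refl  : ∀ a → rel a a ≡ true
    rel-sym   : ∀ a b → rel a b ≡ true → rel b a ≡ true
    rel-trans : ∀ a b d → rel a b ≡ true → rel b d ≡ true → rel a d ≡ true
open Partition public

_⊑_ : {I : Set} → (I → I → Bool) → (I → I → Bool) → Set
R ⊑ S = ∀ a b → R a b ≡ true → S a b ≡ true

OrderIso : (A B : Set) → (A → A → Set) → (B → B → Set) → Set
OrderIso A B _≤A_ _≤B_ =
  Σ (A → B) λ f →
    (∀ a a′ → (a ≤A a′ → f a ≤B f a′) × (f a ≤B f a′ → a ≤A a′)) ×
    (∀ b → ∃ λ a → (f a ≤B b) × (b ≤B f a))

-- Labels z_{i,j}: 1 ≤ i ≤ k, 0 ≤ j ≤ c i  (paper's 1-based side numbering)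

Label : ℕ → (ℕ → ℕ) → Set
Label k c = Σ ℕ λ i → Σ ℕ λ j → (1 ≤ i × i ≤ k) × j ≤ c i

side : ∀ {k c} → Label k c → ℕ
side l = proj₁ l

pos : ∀ {k c} → Label k c → ℕ
pos l = proj₁ (proj₂ l)

Is10 : ∀ {k c} → Label k c → Set
Is10 l = side l ≡ 1 × pos l ≡ 0

Label′ : ℕ → (ℕ → ℕ) → Set
Label′ k c = Σ (Label k c) λ l → ¬ Is10 l

z10 : ∀ {k c} → 3 ≤ k → Label k c
z10 h = 1 , 0 , (s≤s z≤n , ≤-trans (s≤s z≤n) h) , z≤n

zkck : ∀ {k c} → 3 ≤ k → Label k c
zkck {k} {c} h = k , c k , (≤-trans (s≤s z≤n) h , ≤-refl) , ≤-refl

nextSide : ℕ → ℕ → ℕ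
nextSide k i = if i <ᵇ k then suc i else 1

isLabelᵇ : ∀ {k c} → ℕ → ℕ → Label k c → Bool
isLabelᵇ i j l = (side l ≡ᵇ i) ∧ (pos l ≡ᵇ j)

sameLabelᵇ : ∀ {k c} → Label k c → Label k c → Bool
sameLabelᵇ l l′ = isLabelᵇ (side l′) (pos l′) l

αrel : ∀ {k c} → ℕ → ℕ → Label k c → Label k c → Bool
αrel i j l l′ =
  sameLabelᵇ l l′ ∨
  ((isLabelᵇ 1 0 l ∧ isLabelᵇ i j l′) ∨ (isLabelᵇ i j l ∧ isLabelᵇ 1 0 l′))

-- the points from z_{1,0} to z_{i,j} in counterclockwise order; with the
-- labeling of the paper, counterclockwise order starting at z_{1,0} is
-- the lexicographic order on (side, position).
inArcᵇ : ∀ {k c} → ℕ → ℕ → Label k c → Bool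
inArcᵇ i j l = (side l <ᵇ i) ∨ ((side l ≡ᵇ i) ∧ (pos l ≤ᵇ j))

-- β_{ij}: two blocks, the arc from z_{1,0} to z_{i,j} and the rest
βrel : ∀ {k c} → ℕ → ℕ → Label k c → Label k c → Bool
βrel i j l l′ = not (inArcᵇ i j l xor inArcᵇ i j l′)

module Geometry (F : OrderedField) where
  open OrderedField F

  _≤F_ : Carrier → Carrier → Set
  a ≤F b = a <F b ⊎ a ≈ b

  _−_ : Carrier → Carrier → Carrier
  a − b = a + (- b)

  Point : Set
  Point = Carrier × Carrier

  _≈ₚ_ : Point → Point → Set
  p ≈ₚ q = (proj₁ p ≈ proj₁ q) × (proj₂ p ≈ proj₂ q)

  -- orientation determinant; positive iff a, b, d counterclockwise
  orient : Point → Point → Point → Carrier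
  orient a b d =
    ((proj₁ b − proj₁ a) * (proj₂ d − proj₂ a)) −
    ((proj₂ b − proj₂ a) * (proj₁ d − proj₁ a))

  lerp : Point → Point → Carrier → Point
  lerp a b s =
    (((1# − s) * proj₁ a) + (s * proj₁ b)) ,
    (((1# − s) * proj₂ a) + (s * proj₂ b))

  sumF : ∀ {m} → (Fin m → Carrier) → Carrier
  sumF {zero}  f = 0#
  sumF {suc m} f = f Fin.zero + sumF (λ r → f (Fin.suc r))

  _∈Conv_ : Point → (Point → Set) → Set
  x ∈Conv S =
    ∃ λ m → ∃ λ (q : Fin m → Point) → ∃ λ (w : Fin m → Carrier) →
      (∀ r → S (q r)) × (∀ r → 0# ≤F w r) × (sumF w ≈ 1#) ×
      ((sumF (λ r → w r * proj₁ (q r)) , sumF (λ r → w r * proj₂ (q r))) ≈ₚ x)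

  block : {I : Set} → (I → Point) → Partition I → I → Point → Set
  block p π a x = ∃ λ b → (rel π a b ≡ true) × (x ≈ₚ p b)

  NonCrossing : {I : Set} → (I → Point) → Partition I → Set
  NonCrossing p π = ∀ a b → rel π a b ≡ false →
    ¬ (∃ λ x → (x ∈Conv block p π a) × (x ∈Conv block p π b))

  NC : (I : Set) → (I → Point) → Set
  NC I p = Σ (Partition I) (NonCrossing p)

  _≤NC_ : {I : Set} {p : I → Point} → NC I p → NC I p → Set
  π ≤NC σ = rel (proj₁ π) ⊑ rel (proj₁ σ)

  -- The hypotheses: z_{i,0} (1 ≤ i ≤ k) are the vertices of a convex
  -- k-gon in counterclockwise order (every other vertex strictly to the
  -- left of each directed side), and for 1 ≤ j ≤ c_i the point z_{i,j}
  -- lies in the open side from z_{i,0} to z_{i+1,0}, at parameter t i j,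
  -- strictly increasing in j (counterclockwise order along the side).
  ConvexCCW : ℕ → (ℕ → ℕ → Point) → Set
  ConvexCCW k z = ∀ i m → 1 ≤ i → i ≤ k → 1 ≤ m → m ≤ k →
    m ≢ i → m ≢ nextSide k i →
    0# <F orient (z i 0) (z (nextSide k i) 0) (z m 0)

  SidePoints : ℕ → (ℕ → ℕ) → (ℕ → ℕ → Point) → (ℕ → ℕ → Carrier) → Set
  SidePoints k c z t =
    (∀ i j → 1 ≤ i → i ≤ k → 1 ≤ j → j ≤ c i →
       (0# <F t i j) × (t i j <F 1#) ×
       (z i j ≈ₚ lerp (z i 0) (z (nextSide k i) 0) (t i j))) ×
    (∀ i j → 1 ≤ i → i ≤ k → 1 ≤ j → j < c i → t i j <F t i (suc j))

  labelPoint : ∀ {k c} → (ℕ → ℕ → Point) → Label k c → Point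
  labelPoint z l = z (side l) (pos l)

  InX : ∀ {k c} (h : 3 ≤ k) (z : ℕ → ℕ → Point) → NC (Label k c) (labelPoint z) → Set
  InX h z π = (∀ l → rel (proj₁ π) (z10 h) l ≡ true → Is10 l) ⊎
              (rel (proj₁ π) (z10 h) (zkck h) ≡ true)

  InInterval : ∀ {k c} (z : ℕ → ℕ → Point) → ℕ → ℕ → NC (Label k c) (labelPoint z) → Set
  InInterval z i j π = (αrel i j ⊑ rel (proj₁ π)) × (rel (proj₁ π) ⊑ βrel i j)

{-# OPTIONS --safe #-}

-- Ordering P counterclockwise from z₁₀, i.e. lexicographically by (side, position), any three
-- points in this order have nonnegative orientation, positive unless they lie on one side of the
-- polygon. Hence chords with interleaved endpoints cross, and a chord separates the points on
-- its two arcs by a linear functional.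
--
-- Let π be noncrossing and m the last point of the block of z₁₀. If m = z₁₀ or m = z_{k,c_k},
-- π ∈ X. The point m cannot lie elsewhere on side k, for then z_{k,c_k} would lie on the segment
-- from m to z₁₀. Otherwise π ∈ [α_m, β_m]: a block leaving the arc from z₁₀ to m would cross
-- the chord z₁₀ m or put a point after m into the block of z₁₀.
--
-- X ≅ NC(P ∖ z₁₀) × Bool by restricting π and recording whether z₁₀ ∼ z_{k,c_k}. The inverse
-- adds z₁₀ as a singleton, which is apart from every block because z₁₀ is a vertex, or to the
-- block B of z_{k,c_k}. B ∪ {z₁₀} stays apart from any other block C: the chord from the last
-- point of B ∪ {z₁₀} before C to the first point b of B after C separates them, unless that
-- chord runs along side k; then edge k plus orient(z_{2,0}, ·, b) does.

module Submission where

open import Level using (0ℓ)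
open import Algebra.Bundles using (CommutativeRing)
open import Algebra.Solver.Ring.AlmostCommutativeRing using (_-Raw-AlmostCommutative⟶_; fromCommutativeRing)
open import Data.Integer as ℤ using (ℤ; +_; -[1+_]; _⊖_)
import Data.Integer.Properties as ℤ
open import Data.Nat as ℕ using (ℕ; zero; suc; s≤s; z≤n; _≤_; _<_; _∸_; _≡ᵇ_; _<ᵇ_; _≤ᵇ_)
import Data.Nat.Properties as ℕ
open import Data.Bool using (Bool; true; false; T; not; _xor_; _∧_; b≤b; f≤t) renaming (_≤_ to _≤ᴮ_)
import Data.Bool.Properties as Bool
open import Data.Maybe using (Maybe; just; nothing)
open import Data.Fin using (Fin)
import Data.Fin as Fin
open import Data.Product using (Σ; ∃; ∃₂; _×_; _,_; proj₁; proj₂)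
open import Data.Sum using (_⊎_; inj₁; inj₂)
open import Data.Empty using (⊥; ⊥-elim)
open import Function.Bundles using (Equivalence; mk⇔)
open import Relation.Nullary using (¬_; Dec; yes; no)
open import Relation.Binary.Definitions using (tri<; tri≈; tri>)
open import Relation.Binary.Structures using (IsStrictTotalOrder)
open import Relation.Binary.PropositionalEquality as ≡ using (_≡_; _≢_)
open import Defs

T⇒≡true : ∀ {b} → T b → b ≡ true
T⇒≡true = Equivalence.to Bool.T-≡

≡true⇒T : ∀ {b} → b ≡ true → T b
≡true⇒T = Equivalence.from Bool.T-≡

≡false⇒≢true : ∀ {b} → b ≡ false → b ≢ true
≡false⇒≢true ≡.refl ()

not-xor⇒≡ : ∀ a b → not (a xor b) ≡ true → a ≡ b
not-xor⇒≡ true  true  _ = ≡.refl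
not-xor⇒≡ false false _ = ≡.refl

≡⇒not-xor : ∀ a b → a ≡ b → not (a xor b) ≡ true
≡⇒not-xor true  _ ≡.refl = ≡.refl
≡⇒not-xor false _ ≡.refl = ≡.refl

m≤n∸1⇒m<n : ∀ {m n} → 1 ℕ.≤ n → m ℕ.≤ n ∸ 1 → m ℕ.< n
m≤n∸1⇒m<n {n = suc _} _ = s≤s

m<n⇒m≤n∸1 : ∀ {m n} → m ℕ.< n → m ℕ.≤ n ∸ 1
m<n⇒m≤n∸1 (s≤s m≤n) = m≤n

≤ᴮ-intro : ∀ {x y} → (x ≡ true → y ≡ true) → x ≤ᴮ y
≤ᴮ-intro {false} {false} _ = b≤b
≤ᴮ-intro {false} {true}  _ = f≤t
≤ᴮ-intro {true}  {true}  _ = b≤b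
≤ᴮ-intro {true}  {false} x⇒y with x⇒y ≡.refl
... | ()

≤ᴮ-elim : ∀ {x y} → x ≤ᴮ y → x ≡ true → y ≡ true
≤ᴮ-elim b≤b x≡true = x≡true

pullback : ∀ {I J : Set} → (I → J) → Partition J → Partition I
pullback f P = record
  { rel       = λ a b → rel P (f a) (f b)
  ; rel-refl  = λ a → rel-refl P (f a)
  ; rel-sym   = λ a b → rel-sym P (f a) (f b)
  ; rel-trans = λ a b d → rel-trans P (f a) (f b) (f d)
  }

adjoinSingleton : ∀ {J : Set} → Partition J → Partition (Maybe J)
adjoinSingleton {J} P = record { rel = rel⁺ ; rel-refl = refl⁺ ; rel-sym = sym⁺ ; rel-trans = trans⁺ }
  where
  rel⁺ : Maybe J → Maybe J → Bool
  rel⁺ (just a) (just b) = rel P a b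
  rel⁺ nothing  nothing  = true
  rel⁺ _        _        = false
  refl⁺ : ∀ a → rel⁺ a a ≡ true
  refl⁺ (just a) = rel-refl P a
  refl⁺ nothing  = ≡.refl
  sym⁺ : ∀ a b → rel⁺ a b ≡ true → rel⁺ b a ≡ true
  sym⁺ (just a) (just b) = rel-sym P a b
  sym⁺ nothing  nothing  _ = ≡.refl
  trans⁺ : ∀ a b d → rel⁺ a b ≡ true → rel⁺ b d ≡ true → rel⁺ a d ≡ true
  trans⁺ (just a) (just b) (just d) = rel-trans P a b d
  trans⁺ nothing  nothing  nothing _ _ = ≡.refl

≡false-sym : ∀ {I : Set} (P : Partition I) a b → rel P a b ≡ false → rel P b a ≡ false
≡false-sym P a b a≁b = Bool.¬-not λ b∼a → ≡false⇒≢true a≁b (rel-sym P b a b∼a)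

-- With coefficients in ℤ rather than in R, the ring solver can recognise vanishing coefficients.
module IntegerCoefficients (R : CommutativeRing 0ℓ 0ℓ) where

  open CommutativeRing R
  open import Algebra.Properties.Ring ring using (-‿distribˡ-*; -‿distribʳ-*; -‿involutive; -‿anti-homo-+; -0#≈0#)
  open import Algebra.Properties.Semiring.Mult.TCOptimised semiring using (1+×; ×-homo-+; ×1-homo-*) renaming (_×_ to _·_)
  open import Relation.Binary.Reasoning.Setoid setoid

  ⟦_⟧ℤ : ℤ → Carrier
  ⟦ + n ⟧ℤ      = n · 1#
  ⟦ -[1+ n ] ⟧ℤ = - (suc n · 1#)

  ⊖-homo : ∀ m n → ⟦ m ⊖ n ⟧ℤ ≈ m · 1# + - (n · 1#)
  ⊖-homo zero    zero    = sym (-‿inverseʳ 0#)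
  ⊖-homo (suc m) zero    = begin
    suc m · 1#           ≈⟨ +-identityʳ _ ⟨
    suc m · 1# + 0#      ≈⟨ +-congˡ -0#≈0# ⟨
    suc m · 1# + - 0#    ∎
  ⊖-homo zero    (suc n) = sym (+-identityˡ _)
  ⊖-homo (suc m) (suc n) = begin
    ⟦ suc m ⊖ suc n ⟧ℤ             ≡⟨ ≡.cong ⟦_⟧ℤ (ℤ.[1+m]⊖[1+n]≡m⊖n m n) ⟩
    ⟦ m ⊖ n ⟧ℤ                     ≈⟨ ⊖-homo m n ⟩
    m · 1# + - (n · 1#)             ≈⟨ cancel (m · 1#) (n · 1#) ⟨
    (1# + m · 1#) + - (1# + n · 1#) ≈⟨ +-cong (1+× m 1#) (-‿cong (1+× n 1#)) ⟨
    suc m · 1# + - (suc n · 1#)     ∎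
    where
    cancel : ∀ a b → (1# + a) + - (1# + b) ≈ a + - b
    cancel a b = begin
      (1# + a) + - (1# + b)    ≈⟨ +-cong (+-comm 1# a) (-‿anti-homo-+ 1# b) ⟩
      (a + 1#) + (- b + - 1#)  ≈⟨ +-congˡ (+-comm (- b) (- 1#)) ⟩
      (a + 1#) + (- 1# + - b)  ≈⟨ +-assoc a 1# _ ⟩
      a + (1# + (- 1# + - b))  ≈⟨ +-congˡ (+-assoc 1# (- 1#) (- b)) ⟨
      a + ((1# + - 1#) + - b)  ≈⟨ +-congˡ (+-congʳ (-‿inverseʳ 1#)) ⟩
      a + (0# + - b)           ≈⟨ +-congˡ (+-identityˡ _) ⟩
      a + - b                  ∎

  +-homo : ∀ i j → ⟦ i ℤ.+ j ⟧ℤ ≈ ⟦ i ⟧ℤ + ⟦ j ⟧ℤ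
  +-homo (+ m)      (+ n)      = ×-homo-+ 1# m n
  +-homo (+ m)      -[1+ n ]   = ⊖-homo m (suc n)
  +-homo -[1+ m ]   (+ n)      = trans (⊖-homo n (suc m)) (+-comm _ _)
  +-homo -[1+ m ]   -[1+ n ]   = begin
    - (suc (suc (m ℕ.+ n)) · 1#)          ≡⟨ ≡.cong (λ r → - (suc r · 1#)) (ℕ.+-suc m n) ⟨
    - ((suc m ℕ.+ suc n) · 1#)            ≈⟨ -‿cong (×-homo-+ 1# (suc m) (suc n)) ⟩
    - (suc m · 1# + suc n · 1#)           ≈⟨ -‿anti-homo-+ _ _ ⟩
    - (suc n · 1#) + - (suc m · 1#)       ≈⟨ +-comm _ _ ⟩
    - (suc m · 1#) + - (suc n · 1#)       ∎

  -‿homo : ∀ i → ⟦ ℤ.- i ⟧ℤ ≈ - ⟦ i ⟧ℤ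
  -‿homo (+ zero)  = sym -0#≈0#
  -‿homo (+ suc n) = refl
  -‿homo -[1+ n ]  = sym (-‿involutive _)

  *-homo : ∀ i j → ⟦ i ℤ.* j ⟧ℤ ≈ ⟦ i ⟧ℤ * ⟦ j ⟧ℤ
  *-homo (+ zero)  j         = sym (zeroˡ _)
  *-homo i@(+ suc _) (+ zero) = trans (reflexive (≡.cong ⟦_⟧ℤ (ℤ.*-zeroʳ i))) (sym (zeroʳ _))
  *-homo (+ suc m) (+ suc n) = ×1-homo-* (suc m) (suc n)
  *-homo (+ suc m) -[1+ n ]  = trans (-‿cong (×1-homo-* (suc m) (suc n))) (-‿distribʳ-* _ _)
  *-homo i@(-[1+ _ ]) (+ zero) = trans (reflexive (≡.cong ⟦_⟧ℤ (ℤ.*-zeroʳ i))) (sym (zeroʳ _))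
  *-homo -[1+ m ]  (+ suc n) = trans (-‿cong (×1-homo-* (suc m) (suc n))) (-‿distribˡ-* _ _)
  *-homo -[1+ m ]  -[1+ n ]  = begin
    (suc m ℕ.* suc n) · 1#                ≈⟨ ×1-homo-* (suc m) (suc n) ⟩
    suc m · 1# * (suc n · 1#)             ≈⟨ -‿involutive _ ⟨
    - - (suc m · 1# * (suc n · 1#))       ≈⟨ -‿cong (-‿distribˡ-* _ _) ⟩
    - (- (suc m · 1#) * (suc n · 1#))     ≈⟨ -‿distribʳ-* _ _ ⟩
    - (suc m · 1#) * - (suc n · 1#)       ∎

  ℤ-homomorphism : ℤ.+-*-rawRing -Raw-AlmostCommutative⟶ fromCommutativeRing R
  ℤ-homomorphism = record
    { ⟦_⟧ = ⟦_⟧ℤ ; +-homo = +-homo ; *-homo = *-homo ; -‿homo = -‿homo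
    ; 0-homo = refl ; 1-homo = refl }

  ≟-coefficients : ∀ i j → Maybe (⟦ i ⟧ℤ ≈ ⟦ j ⟧ℤ)
  ≟-coefficients i j with i ℤ.≟ j
  ... | yes ≡.refl = just refl
  ... | no _       = nothing

  open import Algebra.Solver.Ring ℤ.+-*-rawRing (fromCommutativeRing R) ℤ-homomorphism ≟-coefficients public
    using (solve; _:=_; _:+_; _:*_; :-_; _:-_; con; Polynomial)

module OrderedFieldProperties (F : OrderedField) where

  open OrderedField F public
  open Geometry F public using () renaming (_≤F_ to infix 4 _≤F_; _−_ to infixl 6 _−_)
  open IntegerCoefficients commRing public
  open import Algebra.Properties.Ring ring using (-0#≈0#)
  private
    module <F = IsStrictTotalOrder <F-isStrictTotalOrder
    import Relation.Binary.Construct.StrictToNonStrict _≈_ _<F_ as ≤F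

  <-trans : ∀ {a b d} → a <F b → b <F d → a <F d
  <-trans = <F.trans

  <-irrefl : ∀ {a b} → a ≈ b → ¬ (a <F b)
  <-irrefl = <F.irrefl

  <-respʳ-≈ : ∀ {a b b′} → b ≈ b′ → a <F b → a <F b′
  <-respʳ-≈ = <F.<-respʳ-≈

  <-respˡ-≈ : ∀ {a a′ b} → a ≈ a′ → a <F b → a′ <F b
  <-respˡ-≈ = <F.<-respˡ-≈

  ≤-reflexive : ∀ {a b} → a ≈ b → a ≤F b
  ≤-reflexive = inj₂

  <⇒≤ : ∀ {a b} → a <F b → a ≤F b
  <⇒≤ = inj₁

  ≤-respʳ-≈ : ∀ {a b b′} → b ≈ b′ → a ≤F b → a ≤F b′
  ≤-respʳ-≈ = ≤F.≤-respʳ-≈ trans <-respʳ-≈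

  ≤-respˡ-≈ : ∀ {a a′ b} → a ≈ a′ → a ≤F b → a′ ≤F b
  ≤-respˡ-≈ = ≤F.≤-respˡ-≈ sym trans <-respˡ-≈

  <-≤-trans : ∀ {a b d} → a <F b → b ≤F d → a <F d
  <-≤-trans = ≤F.<-≤-trans <-trans <-respʳ-≈

  ≤-trans : ∀ {a b d} → a ≤F b → b ≤F d → a ≤F d
  ≤-trans = ≤F.trans isEquivalence (<-respʳ-≈ , <-respˡ-≈) <-trans

  <⇒≱ : ∀ {a b} → a <F b → ¬ (b ≤F a)
  <⇒≱ a<b b≤a = <-irrefl refl (<-≤-trans a<b b≤a)

  +-monoˡ-< : ∀ {a b} c → a <F b → a + c <F b + c
  +-monoˡ-< = +-monoʳ-<F

  +-monoʳ-< : ∀ {a b} c → a <F b → c + a <F c + b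
  +-monoʳ-< c a<b = <-respˡ-≈ (+-comm _ c) (<-respʳ-≈ (+-comm _ c) (+-monoˡ-< c a<b))

  +-monoˡ-≤ : ∀ {a b} c → a ≤F b → a + c ≤F b + c
  +-monoˡ-≤ c (inj₁ a<b) = inj₁ (+-monoˡ-< c a<b)
  +-monoˡ-≤ c (inj₂ a≈b) = inj₂ (+-congʳ a≈b)

  +-monoʳ-≤ : ∀ {a b} c → a ≤F b → c + a ≤F c + b
  +-monoʳ-≤ c (inj₁ a<b) = inj₁ (+-monoʳ-< c a<b)
  +-monoʳ-≤ c (inj₂ a≈b) = inj₂ (+-congˡ a≈b)

  pos+nonNeg⇒pos : ∀ {a b} → 0# <F a → 0# ≤F b → 0# <F a + b
  pos+nonNeg⇒pos {a} 0<a 0≤b =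
    <-≤-trans (<-respˡ-≈ (+-identityʳ 0#) (+-monoˡ-< 0# 0<a)) (+-monoʳ-≤ a 0≤b)

  nonNeg+pos⇒pos : ∀ {a b} → 0# ≤F a → 0# <F b → 0# <F a + b
  nonNeg+pos⇒pos 0≤a 0<b = <-respʳ-≈ (+-comm _ _) (pos+nonNeg⇒pos 0<b 0≤a)

  nonNeg+nonNeg⇒nonNeg : ∀ {a b} → 0# ≤F a → 0# ≤F b → 0# ≤F a + b
  nonNeg+nonNeg⇒nonNeg (inj₁ 0<a) 0≤b = inj₁ (pos+nonNeg⇒pos 0<a 0≤b)
  nonNeg+nonNeg⇒nonNeg (inj₂ 0≈a) 0≤b =
    ≤-respʳ-≈ (+-congʳ 0≈a) (≤-respˡ-≈ (+-identityˡ 0#) (+-monoʳ-≤ 0# 0≤b))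

  nonPos+nonPos⇒nonPos : ∀ {a b} → a ≤F 0# → b ≤F 0# → a + b ≤F 0#
  nonPos+nonPos⇒nonPos {a} {b} a≤0 b≤0 =
    ≤-trans (+-monoˡ-≤ b a≤0) (≤-respˡ-≈ (sym (+-identityˡ b)) b≤0)

  x<y⇒0<y−x : ∀ {a b} → a <F b → 0# <F b − a
  x<y⇒0<y−x {a} a<b = <-respˡ-≈ (-‿inverseʳ a) (+-monoˡ-< (- a) a<b)

  x≤y⇒0≤y−x : ∀ {a b} → a ≤F b → 0# ≤F b − a
  x≤y⇒0≤y−x (inj₁ a<b)     = inj₁ (x<y⇒0<y−x a<b)
  x≤y⇒0≤y−x {a} (inj₂ a≈b) = inj₂ (trans (sym (-‿inverseʳ a)) (+-congʳ a≈b))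

  0<y−x⇒x<y : ∀ {a b} → 0# <F b − a → a <F b
  0<y−x⇒x<y {a} {b} 0<b−a =
    <-respʳ-≈ (solve 2 (λ a b → (b :- a) :+ a := b) refl a b)
      (<-respˡ-≈ (+-identityˡ a) (+-monoˡ-< a 0<b−a))

  0≤y−x⇒x≤y : ∀ {a b} → 0# ≤F b − a → a ≤F b
  0≤y−x⇒x≤y (inj₁ 0<b−a)       = inj₁ (0<y−x⇒x<y 0<b−a)
  0≤y−x⇒x≤y {a} {b} (inj₂ 0≈b−a) = inj₂ (begin
    a              ≈⟨ +-identityˡ a ⟨
    0# + a         ≈⟨ +-congʳ 0≈b−a ⟩
    (b − a) + a    ≈⟨ solve 2 (λ a b → (b :- a) :+ a := b) refl a b ⟩
    b              ∎)
    where open import Relation.Binary.Reasoning.Setoid setoid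

  pos⇒-neg : ∀ {a} → 0# <F a → - a <F 0#
  pos⇒-neg {a} 0<a = <-respʳ-≈ (-‿inverseʳ a) (<-respˡ-≈ (+-identityˡ (- a)) (+-monoˡ-< (- a) 0<a))

  neg⇒-pos : ∀ {a} → a <F 0# → 0# <F - a
  neg⇒-pos {a} a<0 = <-respʳ-≈ (+-identityˡ (- a)) (<-respˡ-≈ (-‿inverseʳ a) (+-monoˡ-< (- a) a<0))

  nonNeg⇒-nonPos : ∀ {a} → 0# ≤F a → - a ≤F 0#
  nonNeg⇒-nonPos (inj₁ 0<a) = inj₁ (pos⇒-neg 0<a)
  nonNeg⇒-nonPos (inj₂ 0≈a) = inj₂ (trans (-‿cong (sym 0≈a)) -0#≈0#)

  nonPos⇒-nonNeg : ∀ {a} → a ≤F 0# → 0# ≤F - a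
  nonPos⇒-nonNeg (inj₁ a<0) = inj₁ (neg⇒-pos a<0)
  nonPos⇒-nonNeg (inj₂ a≈0) = inj₂ (sym (trans (-‿cong a≈0) -0#≈0#))

  nonNeg*nonNeg⇒nonNeg : ∀ {a b} → 0# ≤F a → 0# ≤F b → 0# ≤F a * b
  nonNeg*nonNeg⇒nonNeg (inj₁ 0<a) (inj₁ 0<b) = inj₁ (*-pos 0<a 0<b)
  nonNeg*nonNeg⇒nonNeg {a} _ (inj₂ 0≈b)     = inj₂ (trans (sym (zeroʳ a)) (*-congˡ 0≈b))
  nonNeg*nonNeg⇒nonNeg {b = b} (inj₂ 0≈a) _ = inj₂ (trans (sym (zeroˡ b)) (*-congʳ 0≈a))

  pos*neg⇒neg : ∀ {a b} → 0# <F a → b <F 0# → a * b <F 0#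
  pos*neg⇒neg {a} {b} 0<a b<0 =
    0<y−x⇒x<y (<-respʳ-≈ (solve 2 (λ a b → a :* (:- b) := con (ℤ.+ 0) :- a :* b) refl a b)
                 (*-pos 0<a (neg⇒-pos b<0)))

  nonNeg*nonPos⇒nonPos : ∀ {a b} → 0# ≤F a → b ≤F 0# → a * b ≤F 0#
  nonNeg*nonPos⇒nonPos {a} {b} 0≤a b≤0 =
    0≤y−x⇒x≤y (≤-respʳ-≈ (solve 2 (λ a b → a :* (:- b) := con (ℤ.+ 0) :- a :* b) refl a b)
                 (nonNeg*nonNeg⇒nonNeg 0≤a (nonPos⇒-nonNeg b≤0)))

  *-cancelˡ-pos : ∀ {a b} → 0# <F a → 0# <F a * b → 0# <F b
  *-cancelˡ-pos {a} {b} 0<a 0<ab with <F.compare 0# b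
  ... | tri< 0<b _ _ = 0<b
  ... | tri≈ _ 0≈b _ = ⊥-elim (<-irrefl (trans (sym (zeroʳ a)) (*-congˡ 0≈b)) 0<ab)
  ... | tri> _ _ b<0 = ⊥-elim (<-irrefl refl (<-trans 0<ab (pos*neg⇒neg 0<a b<0)))

  pos-inverse : ∀ {d} → 0# <F d → Σ Carrier λ e → (d * e ≈ 1#) × (0# <F e)
  pos-inverse {d} 0<d with inverse d (λ d≈0 → <-irrefl (sym d≈0) 0<d)
  ... | e , de≈1 = e , de≈1 , *-cancelˡ-pos 0<d (<-respʳ-≈ (sym de≈1) 0<F1)

  mix : Carrier → Carrier → Carrier → Carrier
  mix s x y = (1# − s) * x + s * y

  mix-posˡ : ∀ {s x y} → 0# ≤F s → s <F 1# → 0# <F x → 0# ≤F y → 0# <F mix s x y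
  mix-posˡ 0≤s s<1 0<x 0≤y = pos+nonNeg⇒pos (*-pos (x<y⇒0<y−x s<1) 0<x) (nonNeg*nonNeg⇒nonNeg 0≤s 0≤y)

  mix-posʳ : ∀ {s x y} → 0# <F s → s ≤F 1# → 0# ≤F x → 0# <F y → 0# <F mix s x y
  mix-posʳ 0<s s≤1 0≤x 0<y = nonNeg+pos⇒pos (nonNeg*nonNeg⇒nonNeg (x≤y⇒0≤y−x s≤1) 0≤x) (*-pos 0<s 0<y)

  mix-nonNeg : ∀ {s x y} → 0# ≤F s → s ≤F 1# → 0# ≤F x → 0# ≤F y → 0# ≤F mix s x y
  mix-nonNeg 0≤s s≤1 0≤x 0≤y =
    nonNeg+nonNeg⇒nonNeg (nonNeg*nonNeg⇒nonNeg (x≤y⇒0≤y−x s≤1) 0≤x) (nonNeg*nonNeg⇒nonNeg 0≤s 0≤y)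

  mix-zero : ∀ {s x y} → x ≈ 0# → y ≈ 0# → mix s x y ≈ 0#
  mix-zero x≈0 y≈0 = trans (+-cong (trans (*-congˡ x≈0) (zeroʳ _)) (trans (*-congˡ y≈0) (zeroʳ _))) (+-identityʳ 0#)

module PlaneGeometry (F : OrderedField) where

  open OrderedFieldProperties F public
  open Geometry F public hiding (_≤F_; _−_)

  ≈ₚ-refl : ∀ {p} → p ≈ₚ p
  ≈ₚ-refl = refl , refl

  ≈ₚ-sym : ∀ {p q} → p ≈ₚ q → q ≈ₚ p
  ≈ₚ-sym (e₁ , e₂) = sym e₁ , sym e₂

  ≈ₚ-trans : ∀ {p q r} → p ≈ₚ q → q ≈ₚ r → p ≈ₚ r
  ≈ₚ-trans (e₁ , e₂) (f₁ , f₂) = trans e₁ f₁ , trans e₂ f₂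

  orient-cong : ∀ {a a′ b b′ d d′} → a ≈ₚ a′ → b ≈ₚ b′ → d ≈ₚ d′ → orient a b d ≈ orient a′ b′ d′
  orient-cong (a₁ , a₂) (b₁ , b₂) (d₁ , d₂) =
    +-cong (*-cong (+-cong b₁ (-‿cong a₁)) (+-cong d₂ (-‿cong a₂)))
           (-‿cong (*-cong (+-cong b₂ (-‿cong a₂)) (+-cong d₁ (-‿cong a₁))))

  private
    Pt : ℕ → Set
    Pt n = Polynomial n × Polynomial n

    :orient : ∀ {n} → Pt n → Pt n → Pt n → Polynomial n
    :orient (a₁ , a₂) (b₁ , b₂) (d₁ , d₂) = ((b₁ :- a₁) :* (d₂ :- a₂)) :- ((b₂ :- a₂) :* (d₁ :- a₁))

    :mix : ∀ {n} → Polynomial n → Polynomial n → Polynomial n → Polynomial n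
    :mix s x y = (con (ℤ.+ 1) :- s) :* x :+ s :* y

    :lerp : ∀ {n} → Pt n → Pt n → Polynomial n → Pt n
    :lerp (v₁ , v₂) (u₁ , u₂) s = :mix s v₁ u₁ , :mix s v₂ u₂

  orient-rotate : ∀ a b d → orient a b d ≈ orient b d a
  orient-rotate (a₁ , a₂) (b₁ , b₂) (d₁ , d₂) =
    solve 6 (λ a₁ a₂ b₁ b₂ d₁ d₂ →
        :orient (a₁ , a₂) (b₁ , b₂) (d₁ , d₂) := :orient (b₁ , b₂) (d₁ , d₂) (a₁ , a₂))
      refl a₁ a₂ b₁ b₂ d₁ d₂

  orient-swap : ∀ a b d → orient a b d ≈ - orient a d b
  orient-swap (a₁ , a₂) (b₁ , b₂) (d₁ , d₂) =
    solve 6 (λ a₁ a₂ b₁ b₂ d₁ d₂ →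
        :orient (a₁ , a₂) (b₁ , b₂) (d₁ , d₂) := :- :orient (a₁ , a₂) (d₁ , d₂) (b₁ , b₂))
      refl a₁ a₂ b₁ b₂ d₁ d₂

  orient-aab : ∀ a b → orient a a b ≈ 0#
  orient-aab (a₁ , a₂) (b₁ , b₂) =
    solve 4 (λ a₁ a₂ b₁ b₂ → :orient (a₁ , a₂) (a₁ , a₂) (b₁ , b₂) := con (ℤ.+ 0)) refl a₁ a₂ b₁ b₂

  orient-abb : ∀ a b → orient a b b ≈ 0#
  orient-abb (a₁ , a₂) (b₁ , b₂) =
    solve 4 (λ a₁ a₂ b₁ b₂ → :orient (a₁ , a₂) (b₁ , b₂) (b₁ , b₂) := con (ℤ.+ 0)) refl a₁ a₂ b₁ b₂

  orient-aba : ∀ a b → orient a b a ≈ 0#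
  orient-aba (a₁ , a₂) (b₁ , b₂) =
    solve 4 (λ a₁ a₂ b₁ b₂ → :orient (a₁ , a₂) (b₁ , b₂) (a₁ , a₂) := con (ℤ.+ 0)) refl a₁ a₂ b₁ b₂

  orient-lerp₁ : ∀ v u s b d → orient (lerp v u s) b d ≈ mix s (orient v b d) (orient u b d)
  orient-lerp₁ (v₁ , v₂) (u₁ , u₂) s (b₁ , b₂) (d₁ , d₂) =
    solve 9 (λ v₁ v₂ u₁ u₂ s b₁ b₂ d₁ d₂ →
        :orient (:lerp (v₁ , v₂) (u₁ , u₂) s) (b₁ , b₂) (d₁ , d₂)
          := :mix s (:orient (v₁ , v₂) (b₁ , b₂) (d₁ , d₂)) (:orient (u₁ , u₂) (b₁ , b₂) (d₁ , d₂)))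
      refl v₁ v₂ u₁ u₂ s b₁ b₂ d₁ d₂

  orient-lerp₂ : ∀ a v u s d → orient a (lerp v u s) d ≈ mix s (orient a v d) (orient a u d)
  orient-lerp₂ (a₁ , a₂) (v₁ , v₂) (u₁ , u₂) s (d₁ , d₂) =
    solve 9 (λ a₁ a₂ v₁ v₂ u₁ u₂ s d₁ d₂ →
        :orient (a₁ , a₂) (:lerp (v₁ , v₂) (u₁ , u₂) s) (d₁ , d₂)
          := :mix s (:orient (a₁ , a₂) (v₁ , v₂) (d₁ , d₂)) (:orient (a₁ , a₂) (u₁ , u₂) (d₁ , d₂)))
      refl a₁ a₂ v₁ v₂ u₁ u₂ s d₁ d₂

  orient-lerp₃ : ∀ a b v u s → orient a b (lerp v u s) ≈ mix s (orient a b v) (orient a b u)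
  orient-lerp₃ (a₁ , a₂) (b₁ , b₂) (v₁ , v₂) (u₁ , u₂) s =
    solve 9 (λ a₁ a₂ b₁ b₂ v₁ v₂ u₁ u₂ s →
        :orient (a₁ , a₂) (b₁ , b₂) (:lerp (v₁ , v₂) (u₁ , u₂) s)
          := :mix s (:orient (a₁ , a₂) (b₁ , b₂) (v₁ , v₂)) (:orient (a₁ , a₂) (b₁ , b₂) (u₁ , u₂)))
      refl a₁ a₂ b₁ b₂ v₁ v₂ u₁ u₂ s

  orient-lerp-lerp : ∀ v u s₁ s₂ d → orient (lerp v u s₁) (lerp v u s₂) d ≈ (s₂ − s₁) * orient v u d
  orient-lerp-lerp (v₁ , v₂) (u₁ , u₂) s₁ s₂ (d₁ , d₂) =
    solve 8 (λ v₁ v₂ u₁ u₂ s₁ s₂ d₁ d₂ →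
        :orient (:lerp (v₁ , v₂) (u₁ , u₂) s₁) (:lerp (v₁ , v₂) (u₁ , u₂) s₂) (d₁ , d₂)
          := (s₂ :- s₁) :* :orient (v₁ , v₂) (u₁ , u₂) (d₁ , d₂))
      refl v₁ v₂ u₁ u₂ s₁ s₂ d₁ d₂

  orient-plücker : ∀ x e y p q →
    orient x y q * orient x e p ≈ orient x y p * orient x e q + orient x p q * orient x e y
  orient-plücker (x₁ , x₂) (e₁ , e₂) (y₁ , y₂) (p₁ , p₂) (q₁ , q₂) =
    solve 10 (λ x₁ x₂ e₁ e₂ y₁ y₂ p₁ p₂ q₁ q₂ →
        let x = (x₁ , x₂); e = (e₁ , e₂); y = (y₁ , y₂); p = (p₁ , p₂); q = (q₁ , q₂) in
        :orient x y q :* :orient x e p := :orient x y p :* :orient x e q :+ :orient x p q :* :orient x e y)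
      refl x₁ x₂ e₁ e₂ y₁ y₂ p₁ p₂ q₁ q₂

  lerp-0 : ∀ v u → lerp v u 0# ≈ₚ v
  lerp-0 (v₁ , v₂) (u₁ , u₂) =
    solve 2 (λ v u → :mix (con (ℤ.+ 0)) v u := v) refl v₁ u₁ ,
    solve 2 (λ v u → :mix (con (ℤ.+ 0)) v u := v) refl v₂ u₂

  lerp-1 : ∀ v u → lerp v u 1# ≈ₚ u
  lerp-1 (v₁ , v₂) (u₁ , u₂) =
    solve 2 (λ v u → :mix (con (ℤ.+ 1)) v u := u) refl v₁ u₁ ,
    solve 2 (λ v u → :mix (con (ℤ.+ 1)) v u := u) refl v₂ u₂

  record AffineForm : Set where
    constructor affineForm
    field
      coeffˣ coeffʸ const : Carrier

  open AffineForm

  eval : AffineForm → Point → Carrier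
  eval g (x , y) = (coeffˣ g * x + coeffʸ g * y) + const g

  eval-cong : ∀ g {p q} → p ≈ₚ q → eval g p ≈ eval g q
  eval-cong g (e₁ , e₂) = +-congʳ (+-cong (*-congˡ e₁) (*-congˡ e₂))

  _⊕_ : AffineForm → AffineForm → AffineForm
  g ⊕ h = affineForm (coeffˣ g + coeffˣ h) (coeffʸ g + coeffʸ h) (const g + const h)

  eval-⊕ : ∀ g h p → eval (g ⊕ h) p ≈ eval g p + eval h p
  eval-⊕ (affineForm a b c) (affineForm a′ b′ c′) (x , y) =
    solve 8 (λ a b c a′ b′ c′ x y →
        ((a :+ a′) :* x :+ (b :+ b′) :* y) :+ (c :+ c′) := ((a :* x :+ b :* y) :+ c) :+ ((a′ :* x :+ b′ :* y) :+ c′))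
      refl a b c a′ b′ c′ x y

  orientForm : Point → Point → AffineForm
  orientForm (a₁ , a₂) (b₁ , b₂) =
    affineForm (- (b₂ − a₂)) (b₁ − a₁) (- ((b₁ − a₁) * a₂) + (b₂ − a₂) * a₁)

  eval-orientForm : ∀ a b d → eval (orientForm a b) d ≈ orient a b d
  eval-orientForm (a₁ , a₂) (b₁ , b₂) (d₁ , d₂) =
    solve 6 (λ a₁ a₂ b₁ b₂ d₁ d₂ →
        ((:- (b₂ :- a₂)) :* d₁ :+ (b₁ :- a₁) :* d₂) :+ (:- ((b₁ :- a₁) :* a₂) :+ (b₂ :- a₂) :* a₁)
          := :orient (a₁ , a₂) (b₁ , b₂) (d₁ , d₂))
      refl a₁ a₂ b₁ b₂ d₁ d₂

  private
    tail : ∀ {A : Set} {m} → (Fin (suc m) → A) → Fin m → A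
    tail f r = f (Fin.suc r)

  sumF-eval : ∀ g m (w : Fin m → Carrier) (q : Fin m → Point) →
    sumF (λ r → w r * eval g (q r)) ≈
      (coeffˣ g * sumF (λ r → w r * proj₁ (q r)) + coeffʸ g * sumF (λ r → w r * proj₂ (q r))) + const g * sumF w
  sumF-eval (affineForm a b c) zero w q =
    solve 3 (λ a b c → con (ℤ.+ 0) := (a :* con (ℤ.+ 0) :+ b :* con (ℤ.+ 0)) :+ c :* con (ℤ.+ 0)) refl a b c
  sumF-eval g@(affineForm a b c) (suc m) w q =
    trans (+-congˡ (sumF-eval g m (tail w) (tail q)))
      (solve 9 (λ a b c w₀ x₀ y₀ Sx Sy S →
          w₀ :* ((a :* x₀ :+ b :* y₀) :+ c) :+ ((a :* Sx :+ b :* Sy) :+ c :* S)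
            := (a :* (w₀ :* x₀ :+ Sx) :+ b :* (w₀ :* y₀ :+ Sy)) :+ c :* (w₀ :+ S))
        refl a b c (w Fin.zero) (proj₁ (q Fin.zero)) (proj₂ (q Fin.zero)) _ _ _)

  sumF-nonNeg : ∀ m (w v : Fin m → Carrier) → (∀ r → 0# ≤F w r) → (∀ r → 0# ≤F v r) →
    0# ≤F sumF (λ r → w r * v r)
  sumF-nonNeg zero    w v _  _  = ≤-reflexive refl
  sumF-nonNeg (suc m) w v w≥0 v≥0 =
    nonNeg+nonNeg⇒nonNeg (nonNeg*nonNeg⇒nonNeg (w≥0 Fin.zero) (v≥0 Fin.zero))
      (sumF-nonNeg m (tail w) (tail v) (λ r → w≥0 (Fin.suc r)) (λ r → v≥0 (Fin.suc r)))

  sumF-nonPos : ∀ m (w v : Fin m → Carrier) → (∀ r → 0# ≤F w r) → (∀ r → v r ≤F 0#) →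
    sumF (λ r → w r * v r) ≤F 0#
  sumF-nonPos zero    w v _  _  = ≤-reflexive refl
  sumF-nonPos (suc m) w v w≥0 v≤0 =
    nonPos+nonPos⇒nonPos (nonNeg*nonPos⇒nonPos (w≥0 Fin.zero) (v≤0 Fin.zero))
      (sumF-nonPos m (tail w) (tail v) (λ r → w≥0 (Fin.suc r)) (λ r → v≤0 (Fin.suc r)))

  sumF-pos : ∀ m (w v : Fin m → Carrier) → (∀ r → 0# ≤F w r) → (∀ r → 0# <F v r) → 0# <F sumF w →
    0# <F sumF (λ r → w r * v r)
  sumF-pos zero    w v _   _   0<0 = ⊥-elim (<-irrefl refl 0<0)
  sumF-pos (suc m) w v w≥0 v>0 0<Σw with w≥0 Fin.zero
  ... | inj₁ 0<w₀ =
    pos+nonNeg⇒pos (*-pos 0<w₀ (v>0 Fin.zero)) (sumF-nonNeg m (tail w) (tail v) (λ r → w≥0 (Fin.suc r)) (λ r → <⇒≤ (v>0 (Fin.suc r))))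
  ... | inj₂ 0≈w₀ =
    <-respʳ-≈ (trans (sym (+-identityˡ _)) (+-congʳ (trans (sym (zeroˡ (v Fin.zero))) (*-congʳ 0≈w₀))))
      (sumF-pos m (tail w) (tail v) (λ r → w≥0 (Fin.suc r)) (λ r → v>0 (Fin.suc r))
        (<-respʳ-≈ (trans (+-congʳ (sym 0≈w₀)) (+-identityˡ _)) 0<Σw))

  eval-∈Conv : ∀ g {x} m (q : Fin m → Point) (w : Fin m → Carrier) → sumF w ≈ 1# →
    (sumF (λ r → w r * proj₁ (q r)) , sumF (λ r → w r * proj₂ (q r))) ≈ₚ x →
    eval g x ≈ sumF (λ r → w r * eval g (q r))
  eval-∈Conv g m q w Σw≈1 (e₁ , e₂) =
    trans (eval-cong g (sym e₁ , sym e₂))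
      (trans (+-congˡ (trans (sym (*-identityʳ (const g))) (*-congˡ (sym Σw≈1))))
        (sym (sumF-eval g m w q)))

  separation : ∀ (g : AffineForm) {S T : Point → Set} →
    (∀ y → S y → eval g y ≤F 0#) → (∀ y → T y → 0# <F eval g y) →
    ∀ x → x ∈Conv S → x ∈Conv T → ⊥
  separation g gS gT x (m , q , w , qS , w≥0 , Σw≈1 , xe) (m′ , q′ , w′ , qT , w′≥0 , Σw′≈1 , xe′) =
    <⇒≱ (<-respʳ-≈ (sym (eval-∈Conv g m′ q′ w′ Σw′≈1 xe′))
           (sumF-pos m′ w′ (λ r → eval g (q′ r)) w′≥0 (λ r → gT _ (qT r)) (<-respʳ-≈ (sym Σw′≈1) 0<F1)))
        (≤-respˡ-≈ (sym (eval-∈Conv g m q w Σw≈1 xe)) (sumF-nonPos m w (λ r → eval g (q r)) w≥0 (λ r → gS _ (qS r))))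

  ∈Conv-mono : ∀ {S S′ : Point → Set} {x} → (∀ y → S y → S′ y) → x ∈Conv S → x ∈Conv S′
  ∈Conv-mono S⊆S′ (m , q , w , qS , rest) = m , q , w , (λ r → S⊆S′ _ (qS r)) , rest

  ∈⇒∈Conv : ∀ {S : Point → Set} {p} → S p → p ∈Conv S
  ∈⇒∈Conv {p = p} Sp =
    1 , (λ _ → p) , (λ _ → 1#) , (λ _ → Sp) , (λ _ → <⇒≤ 0<F1) , +-identityʳ 1# ,
    (trans (+-identityʳ _) (*-identityˡ _) , trans (+-identityʳ _) (*-identityˡ _))

  weigh : Carrier → Point → Carrier → Point → Point
  weigh μ (a₁ , a₂) ν (b₁ , b₂) = (μ * a₁ + ν * b₁) , (μ * a₂ + ν * b₂)

  Segment : Point → Point → Point → Set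
  Segment a b x = Σ Carrier λ μ → Σ Carrier λ ν →
    (0# ≤F μ) × (0# ≤F ν) × (μ + ν ≈ 1#) × (x ≈ₚ weigh μ a ν b)

  segment⇒∈Conv : ∀ {S : Point → Set} {a b x} → Segment a b x → S a → S b → x ∈Conv S
  segment⇒∈Conv {S} {a} {b} (μ , ν , μ≥0 , ν≥0 , μ+ν≈1 , (e₁ , e₂)) Sa Sb =
    2 , ends , weights , Sends , weights≥0 , trans (+-congˡ (+-identityʳ ν)) μ+ν≈1 ,
    (trans (+-congˡ (+-identityʳ _)) (sym e₁) , trans (+-congˡ (+-identityʳ _)) (sym e₂))
    where
    ends : Fin 2 → Point
    ends Fin.zero    = a
    ends (Fin.suc _) = b
    weights : Fin 2 → Carrier
    weights Fin.zero    = μ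
    weights (Fin.suc _) = ν
    Sends : ∀ r → S (ends r)
    Sends Fin.zero    = Sa
    Sends (Fin.suc _) = Sb
    weights≥0 : ∀ r → 0# ≤F weights r
    weights≥0 Fin.zero    = μ≥0
    weights≥0 (Fin.suc _) = ν≥0

  segment-cong : ∀ {a a′ b b′ x x′} → a ≈ₚ a′ → b ≈ₚ b′ → x ≈ₚ x′ → Segment a b x → Segment a′ b′ x′
  segment-cong (a₁ , a₂) (b₁ , b₂) x≈x′ (μ , ν , μ≥0 , ν≥0 , μ+ν≈1 , x≈) =
    μ , ν , μ≥0 , ν≥0 , μ+ν≈1 ,
    ≈ₚ-trans (≈ₚ-sym x≈x′) (≈ₚ-trans x≈ (+-cong (*-congˡ a₁) (*-congˡ b₁) , +-cong (*-congˡ a₂) (*-congˡ b₂)))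

  segment-start : ∀ a b → Segment a b a
  segment-start (a₁ , a₂) (b₁ , b₂) =
    1# , 0# , <⇒≤ 0<F1 , ≤-reflexive refl , +-identityʳ 1# ,
    (sym (trans (+-cong (*-identityˡ a₁) (zeroˡ b₁)) (+-identityʳ a₁)) ,
     sym (trans (+-cong (*-identityˡ a₂) (zeroˡ b₂)) (+-identityʳ a₂)))

  blocks-apart : ∀ {I : Set} {p : I → Point} (π : NC I p) {a b u v u′ v′ x} → rel (proj₁ π) a b ≡ false →
    rel (proj₁ π) a u ≡ true → rel (proj₁ π) a v ≡ true → rel (proj₁ π) b u′ ≡ true → rel (proj₁ π) b v′ ≡ true →
    Segment (p u) (p v) x → Segment (p u′) (p v′) x → ⊥
  blocks-apart {p = p} π {a} {b} {u} {v} {u′} {v′} {x} a≁b a∼u a∼v b∼u′ b∼v′ uv u′v′ =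
    proj₂ π a b a≁b (x , segment⇒∈Conv {block p (proj₁ π) a} uv (u , a∼u , ≈ₚ-refl) (v , a∼v , ≈ₚ-refl)
                       , segment⇒∈Conv {block p (proj₁ π) b} u′v′ (u′ , b∼u′ , ≈ₚ-refl) (v′ , b∼v′ , ≈ₚ-refl))

  -- The meeting point is given by Cramer's rule.
  segments-meet : ∀ a b c d → orient a b c <F 0# → 0# ≤F orient a b d →
    0# ≤F orient c d a → orient c d b ≤F 0# → Σ Point λ x → Segment a b x × Segment c d x
  segments-meet a@(a₁ , a₂) b@(b₁ , b₂) c@(c₁ , c₂) d@(d₁ , d₂) A<0 B≥0 C≥0 D≤0
    with pos-inverse (x<y⇒0<y−x (<-≤-trans A<0 B≥0))
  ... | e , [B−A]e≈1 , e>0 = x , on-ab , on-cd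
    where
    A B C D : Carrier
    A = orient a b c
    B = orient a b d
    C = orient c d a
    D = orient c d b
    x : Point
    x = weigh (B * e) c ((- A) * e) d
    on-cd : Segment c d x
    on-cd = B * e , (- A) * e ,
      nonNeg*nonNeg⇒nonNeg B≥0 (<⇒≤ e>0) , nonNeg*nonNeg⇒nonNeg (<⇒≤ (neg⇒-pos A<0)) (<⇒≤ e>0) ,
      trans (sym (distribʳ e B (- A))) [B−A]e≈1 , ≈ₚ-refl
    on-ab : Segment a b x
    on-ab = (- D) * e , C * e ,
      nonNeg*nonNeg⇒nonNeg (nonPos⇒-nonNeg D≤0) (<⇒≤ e>0) , nonNeg*nonNeg⇒nonNeg C≥0 (<⇒≤ e>0) ,
      trans (sym (distribʳ e (- D) C)) (trans (*-congʳ weights-sum) [B−A]e≈1) ,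
      (cramer₁ , cramer₂)
      where
      weights-sum : - D + C ≈ B − A
      weights-sum = solve 8 (λ a₁ a₂ b₁ b₂ c₁ c₂ d₁ d₂ →
          let a = (a₁ , a₂); b = (b₁ , b₂); c = (c₁ , c₂); d = (d₁ , d₂) in
          :- :orient c d b :+ :orient c d a := :orient a b d :- :orient a b c)
        refl a₁ a₂ b₁ b₂ c₁ c₂ d₁ d₂
      cramer₁ : (B * e) * c₁ + ((- A) * e) * d₁ ≈ ((- D) * e) * a₁ + (C * e) * b₁
      cramer₁ = solve 9 (λ a₁ a₂ b₁ b₂ c₁ c₂ d₁ d₂ e →
          let a = (a₁ , a₂); b = (b₁ , b₂); c = (c₁ , c₂); d = (d₁ , d₂) in
          (:orient a b d :* e) :* c₁ :+ ((:- :orient a b c) :* e) :* d₁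
            := ((:- :orient c d b) :* e) :* a₁ :+ (:orient c d a :* e) :* b₁)
        refl a₁ a₂ b₁ b₂ c₁ c₂ d₁ d₂ e
      cramer₂ : (B * e) * c₂ + ((- A) * e) * d₂ ≈ ((- D) * e) * a₂ + (C * e) * b₂
      cramer₂ = solve 9 (λ a₁ a₂ b₁ b₂ c₁ c₂ d₁ d₂ e →
          let a = (a₁ , a₂); b = (b₁ , b₂); c = (c₁ , c₂); d = (d₁ , d₂) in
          (:orient a b d :* e) :* c₂ :+ ((:- :orient a b c) :* e) :* d₂
            := ((:- :orient c d b) :* e) :* a₂ :+ (:orient c d a :* e) :* b₂)
        refl a₁ a₂ b₁ b₂ c₁ c₂ d₁ d₂ e

  lerp-between : ∀ v u {τ₁ τ₂ τ₃} → τ₁ <F τ₂ → τ₂ <F τ₃ → Segment (lerp v u τ₁) (lerp v u τ₃) (lerp v u τ₂)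
  lerp-between (v₁ , v₂) (u₁ , u₂) {τ₁} {τ₂} {τ₃} τ₁<τ₂ τ₂<τ₃
    with pos-inverse (x<y⇒0<y−x (<-trans τ₁<τ₂ τ₂<τ₃))
  ... | e , [τ₃−τ₁]e≈1 , e>0 =
    (τ₃ − τ₂) * e , (τ₂ − τ₁) * e ,
    nonNeg*nonNeg⇒nonNeg (<⇒≤ (x<y⇒0<y−x τ₂<τ₃)) (<⇒≤ e>0) ,
    nonNeg*nonNeg⇒nonNeg (<⇒≤ (x<y⇒0<y−x τ₁<τ₂)) (<⇒≤ e>0) ,
    trans (sym (distribʳ e _ _))
      (trans (*-congʳ (solve 3 (λ a b c → (c :- b) :+ (b :- a) := c :- a) refl τ₁ τ₂ τ₃)) [τ₃−τ₁]e≈1) ,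
    (coordinate v₁ u₁ , coordinate v₂ u₂)
    where
    coordinate : ∀ v u → mix τ₂ v u ≈ ((τ₃ − τ₂) * e) * mix τ₁ v u + ((τ₂ − τ₁) * e) * mix τ₃ v u
    coordinate v u = sym (trans
      (solve 6 (λ τ₁ τ₂ τ₃ e v u →
          ((τ₃ :- τ₂) :* e) :* :mix τ₁ v u :+ ((τ₂ :- τ₁) :* e) :* :mix τ₃ v u
            := ((τ₃ :- τ₁) :* e) :* :mix τ₂ v u)
        refl τ₁ τ₂ τ₃ e v u)
      (trans (*-congʳ [τ₃−τ₁]e≈1) (*-identityˡ _)))

module BoundedSearch (Q : ℕ → Set) (Q? : ∀ n → Dec (Q n)) where

  BoundedGreatest : ℕ → Set
  BoundedGreatest M = Σ ℕ λ n → n ≤ M × Q n × (∀ m → m ≤ M → Q m → m ≤ n)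

  BoundedLeast : ℕ → Set
  BoundedLeast M = Σ ℕ λ n → n ≤ M × Q n × (∀ m → m ≤ M → Q m → n ≤ m)

  NoneBelow : ℕ → Set
  NoneBelow M = ∀ m → m ≤ M → ¬ Q m

  private
    extend-none : ∀ {M} → NoneBelow M → ¬ Q (suc M) → NoneBelow (suc M)
    extend-none none ¬Q m m≤1+M Qm with ℕ.m≤n⇒m<n∨m≡n m≤1+M
    ... | inj₁ m<1+M = none m (ℕ.≤-pred m<1+M) Qm
    ... | inj₂ ≡.refl = ¬Q Qm

  greatest? : ∀ M → BoundedGreatest M ⊎ NoneBelow M
  greatest? zero with Q? zero
  ... | yes Q0 = inj₁ (zero , z≤n , Q0 , λ { m z≤n _ → z≤n })
  ... | no ¬Q0 = inj₂ λ { m z≤n → ¬Q0 }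
  greatest? (suc M) with Q? (suc M)
  ... | yes QM = inj₁ (suc M , ℕ.≤-refl , QM , λ m m≤1+M _ → m≤1+M)
  ... | no ¬QM with greatest? M
  ...   | inj₂ none = inj₂ (extend-none none ¬QM)
  ...   | inj₁ (n , n≤M , Qn , max) = inj₁ (n , ℕ.m≤n⇒m≤1+n n≤M , Qn , max′)
    where
    max′ : ∀ m → m ≤ suc M → Q m → m ≤ n
    max′ m m≤1+M Qm with ℕ.m≤n⇒m<n∨m≡n m≤1+M
    ... | inj₁ m<1+M = max m (ℕ.≤-pred m<1+M) Qm
    ... | inj₂ ≡.refl = ⊥-elim (¬QM Qm)

  least? : ∀ M → BoundedLeast M ⊎ NoneBelow M
  least? zero with Q? zero
  ... | yes Q0 = inj₁ (zero , z≤n , Q0 , λ _ _ _ → z≤n)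
  ... | no ¬Q0 = inj₂ λ { m z≤n → ¬Q0 }
  least? (suc M) with least? M
  ... | inj₁ (n , n≤M , Qn , min) = inj₁ (n , ℕ.m≤n⇒m≤1+n n≤M , Qn , min′)
    where
    min′ : ∀ m → m ≤ suc M → Q m → n ≤ m
    min′ m m≤1+M Qm with ℕ.m≤n⇒m<n∨m≡n m≤1+M
    ... | inj₁ m<1+M = min m (ℕ.≤-pred m<1+M) Qm
    ... | inj₂ ≡.refl = ℕ.m≤n⇒m≤1+n n≤M
  ... | inj₂ none with Q? (suc M)
  ...   | yes QM = inj₁ (suc M , ℕ.≤-refl , QM , min′)
    where
    min′ : ∀ m → m ≤ suc M → Q m → suc M ≤ m
    min′ m m≤1+M Qm with ℕ.m≤n⇒m<n∨m≡n m≤1+M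
    ... | inj₁ m<1+M = ⊥-elim (none m (ℕ.≤-pred m<1+M) Qm)
    ... | inj₂ ≡.refl = ℕ.≤-refl
  ...   | no ¬QM = inj₂ (extend-none none ¬QM)

module Labels (k : ℕ) (c : ℕ → ℕ) where

  Lab : Set
  Lab = Label k c

  IsSide : ℕ → Set
  IsSide i = 1 ≤ i × i ≤ k

  side-isSide : (l : Lab) → IsSide (side l)
  side-isSide (_ , _ , r , _) = r

  pos≤c : (l : Lab) → pos l ≤ c (side l)
  pos≤c (_ , _ , _ , p) = p

  label-≡ : ∀ (l l′ : Lab) → side l ≡ side l′ → pos l ≡ pos l′ → l ≡ l′
  label-≡ (i , j , (a , b) , d) (.i , .j , (a′ , b′) , d′) ≡.refl ≡.refl
    rewrite ℕ.≤-irrelevant a a′ | ℕ.≤-irrelevant b b′ | ℕ.≤-irrelevant d d′ = ≡.refl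

  infix 4 _<L_ _≤L_

  -- The counterclockwise order of the points, starting at z_{1,0}.
  data _<L_ (l l′ : Lab) : Set where
    side< : side l < side l′ → l <L l′
    pos<  : side l ≡ side l′ → pos l < pos l′ → l <L l′

  _≤L_ : Lab → Lab → Set
  l ≤L l′ = (l <L l′) ⊎ (l ≡ l′)

  _<L?_ : ∀ l l′ → Dec (l <L l′)
  l <L? l′ with side l ℕ.<? side l′
  ... | yes s<s′ = yes (side< s<s′)
  ... | no s≮s′ with side l ℕ.≟ side l′
  ...   | no s≢s′ = no λ { (side< s<s′) → s≮s′ s<s′ ; (pos< s≡s′ _) → s≢s′ s≡s′ }
  ...   | yes s≡s′ with pos l ℕ.<? pos l′
  ...     | yes p<p′ = yes (pos< s≡s′ p<p′)
  ...     | no p≮p′ = no λ { (side< s<s′) → s≮s′ s<s′ ; (pos< _ p<p′) → p≮p′ p<p′ }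

  <L-trichotomy : ∀ l l′ → (l <L l′) ⊎ (l ≡ l′) ⊎ (l′ <L l)
  <L-trichotomy l l′ with ℕ.<-cmp (side l) (side l′)
  ... | tri< s<s′ _ _ = inj₁ (side< s<s′)
  ... | tri> _ _ s′<s = inj₂ (inj₂ (side< s′<s))
  ... | tri≈ _ s≡s′ _ with ℕ.<-cmp (pos l) (pos l′)
  ...   | tri< p<p′ _ _ = inj₁ (pos< s≡s′ p<p′)
  ...   | tri≈ _ p≡p′ _ = inj₂ (inj₁ (label-≡ l l′ s≡s′ p≡p′))
  ...   | tri> _ _ p′<p = inj₂ (inj₂ (pos< (≡.sym s≡s′) p′<p))

  <L-trans : ∀ {a b d : Lab} → a <L b → b <L d → a <L d
  <L-trans (side< p)  (side< q)   = side< (ℕ.<-trans p q)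
  <L-trans (side< p)  (pos< e _)  = side< (ℕ.<-≤-trans p (ℕ.≤-reflexive e))
  <L-trans (pos< e _) (side< q)   = side< (ℕ.≤-<-trans (ℕ.≤-reflexive e) q)
  <L-trans (pos< e p) (pos< e′ q) = pos< (≡.trans e e′) (ℕ.<-trans p q)

  <L-irrefl : ∀ {a : Lab} → ¬ (a <L a)
  <L-irrefl (side< p)  = ℕ.<-irrefl ≡.refl p
  <L-irrefl (pos< _ p) = ℕ.<-irrefl ≡.refl p

  <L-asym : ∀ {a b : Lab} → a <L b → ¬ (b <L a)
  <L-asym p q = <L-irrefl (<L-trans p q)

  ≤L-<L-trans : ∀ {a b d : Lab} → a ≤L b → b <L d → a <L d
  ≤L-<L-trans (inj₁ p)      q = <L-trans p q
  ≤L-<L-trans (inj₂ ≡.refl) q = q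

  <L-≤L-trans : ∀ {a b d : Lab} → a <L b → b ≤L d → a <L d
  <L-≤L-trans p (inj₁ q)      = <L-trans p q
  <L-≤L-trans p (inj₂ ≡.refl) = p

  ≤L⇒≯L : ∀ {a b : Lab} → a ≤L b → ¬ (b <L a)
  ≤L⇒≯L (inj₁ p)      q = <L-asym p q
  ≤L⇒≯L (inj₂ ≡.refl) q = <L-irrefl q

  <L⇒side≤ : ∀ {l l′ : Lab} → l <L l′ → side l ≤ side l′
  <L⇒side≤ (side< p)  = ℕ.<⇒≤ p
  <L⇒side≤ (pos< e _) = ℕ.≤-reflexive e

  ≤L⇒side≤ : ∀ {l l′ : Lab} → l ≤L l′ → side l ≤ side l′
  ≤L⇒side≤ (inj₁ p)      = <L⇒side≤ p
  ≤L⇒side≤ (inj₂ ≡.refl) = ℕ.≤-refl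

  <L-sameSide⇒pos< : ∀ {l l′ : Lab} → l <L l′ → side l ≡ side l′ → pos l < pos l′
  <L-sameSide⇒pos< (side< p)  e = ⊥-elim (ℕ.<-irrefl e p)
  <L-sameSide⇒pos< (pos< _ p) _ = p

  Greatest : (Lab → Set) → Set
  Greatest Q = Σ Lab λ m → Q m × (∀ l → Q l → l ≤L m)

  Least : (Lab → Set) → Set
  Least Q = Σ Lab λ m → Q m × (∀ l → Q l → m ≤L l)

  module _ (Q : Lab → Set) (Q? : ∀ l → Dec (Q l)) where

    private
      QAt : ℕ → ℕ → Set
      QAt i j = Σ (IsSide i) λ r → Σ (j ≤ c i) λ p → Q (i , j , r , p)

      QAt? : ∀ i j → Dec (QAt i j)
      QAt? i j with 1 ℕ.≤? i | i ℕ.≤? k | j ℕ.≤? c i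
      ... | no 1≰i  | _       | _      = no λ { (r , _) → 1≰i (proj₁ r) }
      ... | yes _   | no i≰k  | _      = no λ { (r , _) → i≰k (proj₂ r) }
      ... | yes _   | yes _   | no j≰c = no λ { (_ , p , _) → j≰c p }
      ... | yes 1≤i | yes i≤k | yes j≤c with Q? (i , j , (1≤i , i≤k) , j≤c)
      ...   | yes q = yes ((1≤i , i≤k) , j≤c , q)
      ...   | no ¬q = no λ { (_ , _ , q) → ¬q (≡.subst Q (label-≡ _ _ ≡.refl ≡.refl) q) }

      QOnSide : ℕ → Set
      QOnSide i = Σ ℕ λ j → j ≤ c i × QAt i j

      QOnSide? : ∀ i → Dec (QOnSide i)
      QOnSide? i with BoundedSearch.greatest? (QAt i) (QAt? i) (c i)
      ... | inj₁ (j , j≤c , q , _) = yes (j , j≤c , q)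
      ... | inj₂ none              = no λ { (j , j≤c , q) → none j j≤c q }

      at : ∀ {l} → Q l → QAt (side l) (pos l)
      at {l} q = side-isSide l , pos≤c l , q

      onSide : ∀ {l} → Q l → QOnSide (side l)
      onSide {l} q = pos l , pos≤c l , at q

      moveSide : ∀ {l i} → Q l → side l ≡ i → QAt i (pos l) × pos l ≤ c i
      moveSide {l} q ≡.refl = at q , pos≤c l

    greatest? : Greatest Q ⊎ (∀ l → ¬ Q l)
    greatest? with BoundedSearch.greatest? QOnSide QOnSide? k
    ... | inj₂ none = inj₂ λ l q → none (side l) (proj₂ (side-isSide l)) (onSide q)
    ... | inj₁ (i , _ , (j₀ , j₀≤c , q₀) , maxSide) with BoundedSearch.greatest? (QAt i) (QAt? i) (c i)
    ...   | inj₂ none = ⊥-elim (none j₀ j₀≤c q₀)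
    ...   | inj₁ (j , _ , (r , p , q) , maxPos) = inj₁ ((i , j , r , p) , q , below)
      where
      below : ∀ l → Q l → l ≤L (i , j , r , p)
      below l ql with ℕ.m≤n⇒m<n∨m≡n (maxSide (side l) (proj₂ (side-isSide l)) (onSide ql))
      ... | inj₁ s<i = inj₁ (side< s<i)
      ... | inj₂ s≡i with ℕ.m≤n⇒m<n∨m≡n (maxPos (pos l) (proj₂ (moveSide ql s≡i)) (proj₁ (moveSide ql s≡i)))
      ...   | inj₁ p<j = inj₁ (pos< s≡i p<j)
      ...   | inj₂ p≡j = inj₂ (label-≡ _ _ s≡i p≡j)

    least? : Least Q ⊎ (∀ l → ¬ Q l)
    least? with BoundedSearch.least? QOnSide QOnSide? k
    ... | inj₂ none = inj₂ λ l q → none (side l) (proj₂ (side-isSide l)) (onSide q)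
    ... | inj₁ (i , _ , (j₀ , j₀≤c , q₀) , minSide) with BoundedSearch.least? (QAt i) (QAt? i) (c i)
    ...   | inj₂ none = ⊥-elim (none j₀ j₀≤c q₀)
    ...   | inj₁ (j , _ , (r , p , q) , minPos) = inj₁ ((i , j , r , p) , q , above)
      where
      above : ∀ l → Q l → (i , j , r , p) ≤L l
      above l ql with ℕ.m≤n⇒m<n∨m≡n (minSide (side l) (proj₂ (side-isSide l)) (onSide ql))
      ... | inj₁ i<s = inj₁ (side< i<s)
      ... | inj₂ i≡s with ℕ.m≤n⇒m<n∨m≡n (minPos (pos l) (proj₂ (moveSide ql (≡.sym i≡s))) (proj₁ (moveSide ql (≡.sym i≡s))))
      ...   | inj₁ j<p = inj₁ (pos< i≡s j<p)
      ...   | inj₂ j≡p = inj₂ (label-≡ _ _ i≡s j≡p)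

    greatest : ∀ {l} → Q l → Greatest Q
    greatest q with greatest?
    ... | inj₁ g    = g
    ... | inj₂ none = ⊥-elim (none _ q)

    least : ∀ {l} → Q l → Least Q
    least q with least?
    ... | inj₁ g    = g
    ... | inj₂ none = ⊥-elim (none _ q)

module ConvexPolygon (F : OrderedField) (k : ℕ) (c : ℕ → ℕ)
  (z : ℕ → ℕ → Geometry.Point F) (t : ℕ → ℕ → OrderedField.Carrier F) (3≤k : 3 ℕ.≤ k)
  (convex : Geometry.ConvexCCW F k z) (onSides : Geometry.SidePoints F k c z t) where

  open PlaneGeometry F
  open Labels k c

  next : ℕ → ℕ
  next = nextSide k

  next-<k : ∀ {i} → i ℕ.< k → next i ≡ suc i
  next-<k {i} i<k with i <ᵇ k | ℕ.<⇒<ᵇ i<k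
  ... | true  | _ = ≡.refl
  ... | false | ()

  next-k : next k ≡ 1
  next-k with k <ᵇ k in k<ᵇk
  ... | false = ≡.refl
  ... | true  = ⊥-elim (ℕ.<-irrefl ≡.refl (ℕ.<ᵇ⇒< k k (≡.subst T (≡.sym k<ᵇk) _)))

  next-cases : ∀ {i} → IsSide i → (i ℕ.< k × next i ≡ suc i) ⊎ (i ≡ k × next i ≡ 1)
  next-cases (_ , i≤k) with ℕ.m≤n⇒m<n∨m≡n i≤k
  ... | inj₁ i<k    = inj₁ (i<k , next-<k i<k)
  ... | inj₂ ≡.refl = inj₂ (≡.refl , next-k)

  1≤k : 1 ℕ.≤ k
  1≤k = ℕ.≤-trans (s≤s z≤n) 3≤k

  next-isSide : ∀ {i} → IsSide i → IsSide (next i)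
  next-isSide r with next-cases r
  ... | inj₁ (i<k , e) rewrite e = s≤s z≤n , i<k
  ... | inj₂ (_ , e)   rewrite e = s≤s z≤n , 1≤k

  next-≢ : ∀ {i} → IsSide i → next i ≢ i
  next-≢ {i} r with next-cases r
  ... | inj₁ (_ , e)   rewrite e = λ 1+i≡i → ℕ.<-irrefl (≡.sym 1+i≡i) (ℕ.n<1+n i)
  ... | inj₂ (i≡k , e) rewrite e = λ 1≡i → ℕ.<-irrefl (≡.trans 1≡i i≡k) (ℕ.≤-trans (s≤s (s≤s z≤n)) 3≤k)

  next-next-≢ : ∀ {i} → IsSide i → next (next i) ≢ i
  next-next-≢ {i} r eq with next-cases r
  ... | inj₂ (i≡k , e) = ℕ.<-irrefl 2≡k 3≤k
    where
    2≡k : 2 ≡ k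
    2≡k = ≡.trans (≡.sym (next-<k (ℕ.≤-trans (s≤s (s≤s z≤n)) 3≤k))) (≡.trans (≡.cong next (≡.sym e)) (≡.trans eq i≡k))
  ... | inj₁ (i<k , e) with next-cases {suc i} (s≤s z≤n , i<k)
  ...   | inj₁ (_ , e′) = ℕ.<-irrefl (≡.sym (≡.trans (≡.sym (≡.trans (≡.cong next e) e′)) eq)) (ℕ.m<n⇒m<1+n (ℕ.n<1+n i))
  ...   | inj₂ (1+i≡k , e′) = ℕ.<-irrefl (≡.trans (≡.cong suc 1≡i) 1+i≡k) 3≤k
    where
    1≡i : 1 ≡ i
    1≡i = ≡.trans (≡.sym (≡.trans (≡.cong next e) e′)) eq

  V : ℕ → Point
  V i = z i 0

  edge : ℕ → Point → Carrier
  edge s p = orient (V s) (V (next s)) p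

  edge-vertex-pos : ∀ {s m} → IsSide s → IsSide m → m ≢ s → m ≢ next s → 0# <F edge s (V m)
  edge-vertex-pos {s} {m} (1≤s , s≤k) (1≤m , m≤k) = convex s m 1≤s s≤k 1≤m m≤k

  edge-vertex-nonNeg : ∀ {s m} → IsSide s → IsSide m → 0# ≤F edge s (V m)
  edge-vertex-nonNeg {s} {m} rs rm with m ℕ.≟ s | m ℕ.≟ next s
  ... | yes ≡.refl | _          = ≤-reflexive (sym (orient-aba (V m) (V (next m))))
  ... | no _       | yes ≡.refl = ≤-reflexive (sym (orient-abb (V s) (V (next s))))
  ... | no m≢s     | no m≢s+    = <⇒≤ (edge-vertex-pos rs rm m≢s m≢s+)

  -- Induction on w: the Plücker relation transports positivity from (x, y, w - 1) to (x, y, w).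
  vertices-ccw : ∀ x y w → 1 ℕ.≤ x → x ℕ.< y → y ℕ.< w → w ℕ.≤ k → 0# <F orient (V x) (V y) (V w)
  vertices-ccw x y (suc w) 1≤x x<y y<1+w w≤k with ℕ.m≤n⇒m<n∨m≡n (ℕ.≤-pred y<1+w)
  ... | inj₂ ≡.refl =
    <-respʳ-≈ (sym (orient-rotate (V x) (V y) (V (suc y))))
      (≡.subst (λ n → 0# <F orient (V y) (V n) (V x)) (next-<k w≤k)
        (edge-vertex-pos (ℕ.≤-trans 1≤x (ℕ.<⇒≤ x<y) , ℕ.<⇒≤ w≤k) (1≤x , ℕ.≤-trans (ℕ.<⇒≤ x<y) (ℕ.<⇒≤ w≤k))
          (ℕ.<⇒≢ x<y) (λ x≡next → ℕ.<⇒≢ (ℕ.m<n⇒m<1+n x<y) (≡.trans x≡next (next-<k w≤k)))))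
  ... | inj₁ y<w =
    *-cancelˡ-pos XEP (<-respʳ-≈ (trans (sym (orient-plücker X E Y P Q)) (*-comm _ _))
      (pos+nonNeg⇒pos (*-pos XYP XEQ) (nonNeg*nonNeg⇒nonNeg (<⇒≤ XPQ) XEY)))
    where
    x<w : x ℕ.< w
    x<w = ℕ.<-trans x<y y<w
    x<k : x ℕ.< k
    x<k = ℕ.<-trans x<w w≤k
    rx : IsSide x
    rx = 1≤x , ℕ.<⇒≤ x<k
    rw : IsSide w
    rw = ℕ.≤-trans 1≤x (ℕ.<⇒≤ x<w) , ℕ.<⇒≤ w≤k
    X E Y P Q : Point
    X = V x
    E = V (next x)
    Y = V y
    P = V w
    Q = V (suc w)
    x+1<w : suc x ℕ.< w
    x+1<w = ℕ.≤-<-trans x<y y<w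
    XEP : 0# <F orient X E P
    XEP = edge-vertex-pos rx rw (ℕ.>⇒≢ x<w) (λ w≡ → ℕ.>⇒≢ x+1<w (≡.trans w≡ (next-<k x<k)))
    XEQ : 0# <F orient X E Q
    XEQ = edge-vertex-pos rx (s≤s z≤n , w≤k) (ℕ.>⇒≢ (ℕ.m<n⇒m<1+n x<w))
            (λ w+1≡ → ℕ.>⇒≢ (ℕ.m<n⇒m<1+n x+1<w) (≡.trans w+1≡ (next-<k x<k)))
    XEY : 0# ≤F orient X E Y
    XEY = edge-vertex-nonNeg rx (ℕ.≤-trans 1≤x (ℕ.<⇒≤ x<y) , ℕ.<⇒≤ (ℕ.<-≤-trans y<w (ℕ.<⇒≤ w≤k)))
    XPQ : 0# <F orient X P Q
    XPQ = <-respʳ-≈ (sym (orient-rotate X P Q))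
            (≡.subst (λ n → 0# <F orient P (V n) X) (next-<k w≤k)
              (edge-vertex-pos rw rx (ℕ.<⇒≢ x<w) (λ x≡ → ℕ.<⇒≢ (ℕ.m<n⇒m<1+n x<w) (≡.trans x≡ (next-<k w≤k)))))
    XYP : 0# <F orient X Y P
    XYP = vertices-ccw x y w 1≤x x<y y<w (ℕ.<⇒≤ w≤k)

  vertices-ccw-weak : ∀ x y w → 1 ℕ.≤ x → x ℕ.≤ y → y ℕ.≤ w → w ℕ.≤ k → 0# ≤F orient (V x) (V y) (V w)
  vertices-ccw-weak x y w 1≤x x≤y y≤w w≤k with ℕ.m≤n⇒m<n∨m≡n x≤y | ℕ.m≤n⇒m<n∨m≡n y≤w
  ... | inj₂ ≡.refl | _           = ≤-reflexive (sym (orient-aab (V x) (V w)))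
  ... | inj₁ _      | inj₂ ≡.refl = ≤-reflexive (sym (orient-abb (V x) (V y)))
  ... | inj₁ x<y    | inj₁ y<w    = <⇒≤ (vertices-ccw x y w 1≤x x<y y<w w≤k)

  vertices-ccw-next : ∀ x y s → 1 ℕ.≤ x → x ℕ.≤ y → y ℕ.≤ s → s ℕ.≤ k → 0# ≤F orient (V x) (V y) (V (next s))
  vertices-ccw-next x y s 1≤x x≤y y≤s s≤k with next-cases (ℕ.≤-trans 1≤x (ℕ.≤-trans x≤y y≤s) , s≤k)
  ... | inj₁ (s<k , e) rewrite e = vertices-ccw-weak x y (suc s) 1≤x x≤y (ℕ.m≤n⇒m≤1+n y≤s) s<k
  ... | inj₂ (_ , e)   rewrite e =
    ≤-respʳ-≈ (orient-rotate (V 1) (V x) (V y)) (vertices-ccw-weak 1 x y ℕ.≤-refl 1≤x x≤y (ℕ.≤-trans y≤s s≤k))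

  pt : Lab → Point
  pt = labelPoint z

  -- z_{i,0} sits at parameter 0 of side i; t i 0 is not constrained by the hypotheses.
  param : Lab → Carrier
  param (i , zero , _)  = 0#
  param (i , suc j , _) = t i (suc j)

  pt≈lerp : ∀ l → pt l ≈ₚ lerp (V (side l)) (V (next (side l))) (param l)
  pt≈lerp (i , zero , _)                  = ≈ₚ-sym (lerp-0 _ _)
  pt≈lerp (i , suc j , (1≤i , i≤k) , j≤c) = proj₂ (proj₂ (proj₁ onSides i (suc j) 1≤i i≤k (s≤s z≤n) j≤c))

  pt-onSide : ∀ {s} l → side l ≡ s → pt l ≈ₚ lerp (V s) (V (next s)) (param l)
  pt-onSide l ≡.refl = pt≈lerp l

  param-nonNeg : ∀ l → 0# ≤F param l
  param-nonNeg (i , zero , _)                  = ≤-reflexive refl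
  param-nonNeg (i , suc j , (1≤i , i≤k) , j≤c) = <⇒≤ (proj₁ (proj₁ onSides i (suc j) 1≤i i≤k (s≤s z≤n) j≤c))

  param-pos : ∀ l → 1 ℕ.≤ pos l → 0# <F param l
  param-pos (i , suc j , (1≤i , i≤k) , j≤c) _ = proj₁ (proj₁ onSides i (suc j) 1≤i i≤k (s≤s z≤n) j≤c)

  param-<1 : ∀ l → param l <F 1#
  param-<1 (i , zero , _)                  = 0<F1
  param-<1 (i , suc j , (1≤i , i≤k) , j≤c) = proj₁ (proj₂ (proj₁ onSides i (suc j) 1≤i i≤k (s≤s z≤n) j≤c))

  t-mono : ∀ i → IsSide i → ∀ a b → 1 ℕ.≤ a → a ℕ.< b → b ℕ.≤ c i → t i a <F t i b
  t-mono i (1≤i , i≤k) a (suc b) 1≤a a<1+b 1+b≤c with ℕ.m≤n⇒m<n∨m≡n (ℕ.≤-pred a<1+b)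
  ... | inj₂ ≡.refl = proj₂ onSides i a 1≤i i≤k 1≤a 1+b≤c
  ... | inj₁ a<b    = <-trans (t-mono i (1≤i , i≤k) a b 1≤a a<b (ℕ.<⇒≤ 1+b≤c))
                              (proj₂ onSides i b 1≤i i≤k (ℕ.≤-trans 1≤a (ℕ.<⇒≤ a<b)) 1+b≤c)

  param-mono : ∀ (l l′ : Lab) → side l ≡ side l′ → pos l ℕ.< pos l′ → param l <F param l′
  param-mono (i , zero , _)      (.i , suc j′ , r′ , j′≤c) ≡.refl _   = param-pos (i , suc j′ , r′ , j′≤c) (s≤s z≤n)
  param-mono (i , suc j , r , _) (.i , suc j′ , _ , j′≤c)  ≡.refl j<j′ = t-mono i r (suc j) (suc j′) (s≤s z≤n) j<j′ j′≤c

  orient-pt₁ : ∀ l b d → orient (pt l) b d ≈ mix (param l) (orient (V (side l)) b d) (orient (V (next (side l))) b d)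
  orient-pt₁ l b d = trans (orient-cong (pt≈lerp l) ≈ₚ-refl ≈ₚ-refl) (orient-lerp₁ _ _ (param l) b d)

  orient-pt₂ : ∀ a l d → orient a (pt l) d ≈ mix (param l) (orient a (V (side l)) d) (orient a (V (next (side l))) d)
  orient-pt₂ a l d = trans (orient-cong ≈ₚ-refl (pt≈lerp l) ≈ₚ-refl) (orient-lerp₂ a _ _ (param l) d)

  orient-pt₃ : ∀ a b l → orient a b (pt l) ≈ mix (param l) (orient a b (V (side l))) (orient a b (V (next (side l))))
  orient-pt₃ a b l = trans (orient-cong ≈ₚ-refl ≈ₚ-refl (pt≈lerp l)) (orient-lerp₃ a b _ _ (param l))

  OnSide : ℕ → Lab → Set
  OnSide s l = (side l ≡ s) ⊎ (side l ≡ next s × pos l ≡ 0)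

  edge-cong : ∀ s {p q} → p ≈ₚ q → edge s p ≈ edge s q
  edge-cong s = orient-cong ≈ₚ-refl ≈ₚ-refl

  edge-pt : ∀ s l → edge s (pt l) ≈ mix (param l) (edge s (V (side l))) (edge s (V (next (side l))))
  edge-pt s = orient-pt₃ (V s) (V (next s))

  edge-zero : ∀ {s} l → OnSide s l → edge s (pt l) ≈ 0#
  edge-zero {s} l (inj₁ ≡.refl) =
    trans (edge-pt s l) (mix-zero (orient-aba (V s) (V (next s))) (orient-abb (V s) (V (next s))))
  edge-zero {s} (_ , zero , _) (inj₂ (≡.refl , _)) = orient-abb (V s) (V (next s))

  edge-pos-or-onSide : ∀ {s} → IsSide s → ∀ l → (0# <F edge s (pt l)) ⊎ OnSide s l
  edge-pos-or-onSide {s} rs l with side l ℕ.≟ s | side l ℕ.≟ next s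
  ... | yes l∈s | _    = inj₂ (inj₁ l∈s)
  ... | no l∉s  | no l∉s+ =
    inj₁ (<-respʳ-≈ (sym (edge-pt s l))
      (mix-posˡ (param-nonNeg l) (param-<1 l) (edge-vertex-pos rs (side-isSide l) l∉s l∉s+)
               (edge-vertex-nonNeg rs (next-isSide (side-isSide l)))))
  ... | no _    | yes l∈s+ with pos l ℕ.≟ 0
  ...   | yes p≡0 = inj₂ (inj₂ (l∈s+ , p≡0))
  ...   | no p≢0  =
    inj₁ (<-respʳ-≈ (sym (edge-pt s l))
      (mix-posʳ (param-pos l (ℕ.n≢0⇒n>0 p≢0)) (<⇒≤ (param-<1 l))
        (≤-reflexive (sym (≡.subst (λ n → edge s (V n) ≈ 0#) (≡.sym l∈s+) (orient-abb (V s) (V (next s))))))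
        (≡.subst (λ n → 0# <F edge s (V (next n))) (≡.sym l∈s+)
          (edge-vertex-pos rs (next-isSide (next-isSide rs)) (next-next-≢ rs) (next-≢ (next-isSide rs))))))

  edge-nonNeg : ∀ {s} → IsSide s → ∀ l → 0# ≤F edge s (pt l)
  edge-nonNeg rs l with edge-pos-or-onSide rs l
  ... | inj₁ 0<edge = <⇒≤ 0<edge
  ... | inj₂ l∈s    = ≤-reflexive (sym (edge-zero l l∈s))


  orientL : Lab → Lab → Lab → Carrier
  orientL l₁ l₂ l₃ = orient (pt l₁) (pt l₂) (pt l₃)

  -- Expand the three points along their sides one at a time (orient is affine in each
  -- argument) and reduce to triples of vertices.
  orientL-distinctSides : ∀ l₁ l₂ l₃ → side l₁ ℕ.< side l₂ → side l₂ ℕ.< side l₃ → 0# <F orientL l₁ l₂ l₃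
  orientL-distinctSides l₁ l₂ l₃ s₁<s₂ s₂<s₃ =
    <-respʳ-≈ (sym (orient-pt₁ l₁ (pt l₂) (pt l₃)))
      (mix-posˡ (param-nonNeg l₁) (param-<1 l₁) (pos₂ s₁ (proj₁ (side-isSide l₁)) s₁<s₂)
        (≡.subst (λ n → 0# ≤F orient (V n) (pt l₂) (pt l₃)) (≡.sym (next-<k s₁<k)) (nonNeg₂ (suc s₁) (s≤s z≤n) s₁<s₂)))
    where
    s₁ s₂ s₃ : ℕ
    s₁ = side l₁
    s₂ = side l₂
    s₃ = side l₃
    s₃≤k : s₃ ℕ.≤ k
    s₃≤k = proj₂ (side-isSide l₃)
    s₂<k : s₂ ℕ.< k
    s₂<k = ℕ.<-≤-trans s₂<s₃ s₃≤k
    s₁<k : s₁ ℕ.< k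
    s₁<k = ℕ.<-trans s₁<s₂ s₂<k
    nonNeg₃ : ∀ a b → 1 ℕ.≤ a → a ℕ.≤ b → b ℕ.≤ s₃ → 0# ≤F orient (V a) (V b) (pt l₃)
    nonNeg₃ a b 1≤a a≤b b≤s₃ = ≤-respʳ-≈ (sym (orient-pt₃ (V a) (V b) l₃))
      (mix-nonNeg (param-nonNeg l₃) (<⇒≤ (param-<1 l₃))
        (vertices-ccw-weak a b s₃ 1≤a a≤b b≤s₃ s₃≤k) (vertices-ccw-next a b s₃ 1≤a a≤b b≤s₃ s₃≤k))
    pos₃ : ∀ a b → 1 ℕ.≤ a → a ℕ.< b → b ℕ.< s₃ → 0# <F orient (V a) (V b) (pt l₃)
    pos₃ a b 1≤a a<b b<s₃ = <-respʳ-≈ (sym (orient-pt₃ (V a) (V b) l₃))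
      (mix-posˡ (param-nonNeg l₃) (param-<1 l₃)
        (vertices-ccw a b s₃ 1≤a a<b b<s₃ s₃≤k) (vertices-ccw-next a b s₃ 1≤a (ℕ.<⇒≤ a<b) (ℕ.<⇒≤ b<s₃) s₃≤k))
    nonNeg₂ : ∀ a → 1 ℕ.≤ a → a ℕ.≤ s₂ → 0# ≤F orient (V a) (pt l₂) (pt l₃)
    nonNeg₂ a 1≤a a≤s₂ = ≤-respʳ-≈ (sym (orient-pt₂ (V a) l₂ (pt l₃)))
      (mix-nonNeg (param-nonNeg l₂) (<⇒≤ (param-<1 l₂)) (nonNeg₃ a s₂ 1≤a a≤s₂ (ℕ.<⇒≤ s₂<s₃))
        (≡.subst (λ n → 0# ≤F orient (V a) (V n) (pt l₃)) (≡.sym (next-<k s₂<k))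
          (nonNeg₃ a (suc s₂) 1≤a (ℕ.m≤n⇒m≤1+n a≤s₂) s₂<s₃)))
    pos₂ : ∀ a → 1 ℕ.≤ a → a ℕ.< s₂ → 0# <F orient (V a) (pt l₂) (pt l₃)
    pos₂ a 1≤a a<s₂ = <-respʳ-≈ (sym (orient-pt₂ (V a) l₂ (pt l₃)))
      (mix-posˡ (param-nonNeg l₂) (param-<1 l₂) (pos₃ a s₂ 1≤a a<s₂ s₂<s₃)
        (≡.subst (λ n → 0# ≤F orient (V a) (V n) (pt l₃)) (≡.sym (next-<k s₂<k))
          (nonNeg₃ a (suc s₂) 1≤a (ℕ.m≤n⇒m≤1+n (ℕ.<⇒≤ a<s₂)) s₂<s₃)))

  orientL-sameSide : ∀ l₁ l₂ l₃ → side l₁ ≡ side l₂ →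
    orientL l₁ l₂ l₃ ≈ (param l₂ − param l₁) * edge (side l₁) (pt l₃)
  orientL-sameSide l₁ l₂ l₃ s₁≡s₂ =
    trans (orient-cong (pt≈lerp l₁) (pt-onSide l₂ (≡.sym s₁≡s₂)) ≈ₚ-refl)
          (orient-lerp-lerp _ _ (param l₁) (param l₂) (pt l₃))

  orientL-sameSide₁₂-pos : ∀ l₁ l₂ l₃ → side l₁ ≡ side l₂ → pos l₁ ℕ.< pos l₂ →
    ¬ OnSide (side l₁) l₃ → 0# <F orientL l₁ l₂ l₃
  orientL-sameSide₁₂-pos l₁ l₂ l₃ s₁≡s₂ p₁<p₂ l₃∉s₁ with edge-pos-or-onSide (side-isSide l₁) l₃
  ... | inj₁ 0<edge = <-respʳ-≈ (sym (orientL-sameSide l₁ l₂ l₃ s₁≡s₂))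
                        (*-pos (x<y⇒0<y−x (param-mono l₁ l₂ s₁≡s₂ p₁<p₂)) 0<edge)
  ... | inj₂ l₃∈s₁ = ⊥-elim (l₃∉s₁ l₃∈s₁)

  orientL-sameSide₂₃-pos : ∀ l₁ l₂ l₃ → side l₂ ≡ side l₃ → pos l₂ ℕ.< pos l₃ →
    ¬ OnSide (side l₂) l₁ → 0# <F orientL l₁ l₂ l₃
  orientL-sameSide₂₃-pos l₁ l₂ l₃ s₂≡s₃ p₂<p₃ l₁∉s₂ =
    <-respʳ-≈ (sym (orient-rotate (pt l₁) (pt l₂) (pt l₃))) (orientL-sameSide₁₂-pos l₂ l₃ l₁ s₂≡s₃ p₂<p₃ l₁∉s₂)

  OnCommonSide : Lab → Lab → Lab → Set
  OnCommonSide l₁ l₂ l₃ = Σ ℕ λ s → IsSide s × OnSide s l₁ × OnSide s l₂ × OnSide s l₃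

  ConvexPosition : Lab → Lab → Lab → Set
  ConvexPosition l₁ l₂ l₃ = (0# ≤F orientL l₁ l₂ l₃) × ((0# <F orientL l₁ l₂ l₃) ⊎ OnCommonSide l₁ l₂ l₃)

  private
    convexPosition-sameSide₁₂ : ∀ l₁ l₂ l₃ → side l₁ ≡ side l₂ → pos l₁ ℕ.< pos l₂ → ConvexPosition l₁ l₂ l₃
    convexPosition-sameSide₁₂ l₁ l₂ l₃ s₁≡s₂ p₁<p₂ =
      ≤-respʳ-≈ (sym (orientL-sameSide l₁ l₂ l₃ s₁≡s₂)) (nonNeg*nonNeg⇒nonNeg (<⇒≤ Δ>0) (edge-nonNeg r₁ l₃)) ,
      strictOrCommon (edge-pos-or-onSide r₁ l₃)
      where
      r₁ : IsSide (side l₁)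
      r₁ = side-isSide l₁
      Δ>0 : 0# <F param l₂ − param l₁
      Δ>0 = x<y⇒0<y−x (param-mono l₁ l₂ s₁≡s₂ p₁<p₂)
      strictOrCommon : (0# <F edge (side l₁) (pt l₃)) ⊎ OnSide (side l₁) l₃ →
        (0# <F orientL l₁ l₂ l₃) ⊎ OnCommonSide l₁ l₂ l₃
      strictOrCommon (inj₁ 0<edge) = inj₁ (<-respʳ-≈ (sym (orientL-sameSide l₁ l₂ l₃ s₁≡s₂)) (*-pos Δ>0 0<edge))
      strictOrCommon (inj₂ l₃∈s₁)  = inj₂ (side l₁ , r₁ , inj₁ ≡.refl , inj₁ (≡.sym s₁≡s₂) , l₃∈s₁)

    rotate : ∀ {l₁ l₂ l₃} → ConvexPosition l₂ l₃ l₁ → ConvexPosition l₁ l₂ l₃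
    rotate {l₁} {l₂} {l₃} (nonNeg , strictOrCommon) = ≤-respʳ-≈ rot nonNeg , rotate′ strictOrCommon
      where
      rot : orientL l₂ l₃ l₁ ≈ orientL l₁ l₂ l₃
      rot = sym (orient-rotate (pt l₁) (pt l₂) (pt l₃))
      rotate′ : (0# <F orientL l₂ l₃ l₁) ⊎ OnCommonSide l₂ l₃ l₁ → (0# <F orientL l₁ l₂ l₃) ⊎ OnCommonSide l₁ l₂ l₃
      rotate′ (inj₁ 0<O)                       = inj₁ (<-respʳ-≈ rot 0<O)
      rotate′ (inj₂ (s , r , on₂ , on₃ , on₁))  = inj₂ (s , r , on₁ , on₂ , on₃)

  convexPosition : ∀ {l₁ l₂ l₃} → l₁ <L l₂ → l₂ <L l₃ → ConvexPosition l₁ l₂ l₃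
  convexPosition {l₁} {l₂} {l₃} (pos< s₁≡s₂ p₁<p₂) _ = convexPosition-sameSide₁₂ l₁ l₂ l₃ s₁≡s₂ p₁<p₂
  convexPosition {l₁} {l₂} {l₃} (side< _) (pos< s₂≡s₃ p₂<p₃) =
    rotate {l₁} {l₂} {l₃} (convexPosition-sameSide₁₂ l₂ l₃ l₁ s₂≡s₃ p₂<p₃)
  convexPosition {l₁} {l₂} {l₃} (side< s₁<s₂) (side< s₂<s₃) = <⇒≤ 0<O , inj₁ 0<O
    where
    0<O : 0# <F orientL l₁ l₂ l₃
    0<O = orientL-distinctSides l₁ l₂ l₃ s₁<s₂ s₂<s₃

  orientL-nonNeg : ∀ {l₁ l₂ l₃} → l₁ <L l₂ → l₂ <L l₃ → 0# ≤F orientL l₁ l₂ l₃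
  orientL-nonNeg l₁<l₂ l₂<l₃ = proj₁ (convexPosition l₁<l₂ l₂<l₃)

  between-onSide : ∀ s l₁ l₂ l₃ → side l₁ ≡ s → side l₂ ≡ s → pos l₁ ℕ.< pos l₂ →
    ((side l₃ ≡ s) × (pos l₂ ℕ.< pos l₃)) ⊎ ((side l₃ ≡ next s) × (pos l₃ ≡ 0)) →
    Segment (pt l₁) (pt l₃) (pt l₂)
  between-onSide s l₁ l₂ l₃ s₁≡s s₂≡s p₁<p₂ (inj₁ (s₃≡s , p₂<p₃)) =
    segment-cong (≈ₚ-sym (pt-onSide l₁ s₁≡s)) (≈ₚ-sym (pt-onSide l₃ s₃≡s)) (≈ₚ-sym (pt-onSide l₂ s₂≡s))
      (lerp-between (V s) (V (next s)) (param-mono l₁ l₂ (≡.trans s₁≡s (≡.sym s₂≡s)) p₁<p₂)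
                                       (param-mono l₂ l₃ (≡.trans s₂≡s (≡.sym s₃≡s)) p₂<p₃))
  between-onSide s l₁ l₂ (.(next s) , zero , _) s₁≡s s₂≡s p₁<p₂ (inj₂ (≡.refl , ≡.refl)) =
    segment-cong (≈ₚ-sym (pt-onSide l₁ s₁≡s)) (lerp-1 (V s) (V (next s))) (≈ₚ-sym (pt-onSide l₂ s₂≡s))
      (lerp-between (V s) (V (next s)) (param-mono l₁ l₂ (≡.trans s₁≡s (≡.sym s₂≡s)) p₁<p₂) (param-<1 l₂))

  next≤⇒last : ∀ {s} → IsSide s → next s ℕ.≤ s → (s ≡ k) × (next s ≡ 1)
  next≤⇒last rs next≤s with next-cases rs
  ... | inj₁ (_ , e) = ⊥-elim (ℕ.<-irrefl ≡.refl (ℕ.≤-trans (ℕ.≤-reflexive (≡.sym e)) next≤s))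
  ... | inj₂ last    = last

  -- On a common closed side the order <L is the order along that side, except for z_{1,0}:
  -- it comes first in <L but is the far end of side k.
  between-onCommonSide : ∀ {l₁ l₂ l₃} → l₁ <L l₂ → l₂ <L l₃ → ¬ Is10 l₁ → OnCommonSide l₁ l₂ l₃ →
    Segment (pt l₁) (pt l₃) (pt l₂)
  between-onCommonSide {l₁} {l₂} {l₃} l₁<l₂ l₂<l₃ l₁≢z₁₀ (s , rs , on₁ , on₂ , on₃) =
    between-onSide s l₁ l₂ l₃ s₁≡s s₂≡s (<L-sameSide⇒pos< l₁<l₂ (≡.trans s₁≡s (≡.sym s₂≡s))) l₃-after
    where
    distinct : ∀ {l l′} → l <L l′ → side l ≡ next s → pos l ≡ 0 → side l′ ≡ next s → pos l′ ≡ 0 → ⊥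
    distinct l<l′ e p e′ p′ = <L-irrefl (≡.subst (_ <L_) (label-≡ _ _ (≡.trans e′ (≡.sym e)) (≡.trans p′ (≡.sym p))) l<l′)
    wraps : ∀ {l l′} → l <L l′ → side l ≡ next s → side l′ ≡ s → (s ≡ k) × (next s ≡ 1)
    wraps l<l′ e e′ = next≤⇒last rs (≡.subst₂ ℕ._≤_ e e′ (<L⇒side≤ l<l′))
    first : OnSide s l₁ → OnSide s l₂ → side l₁ ≡ s
    first (inj₁ e)         _                = e
    first (inj₂ (e₁ , p₁)) (inj₂ (e₂ , p₂)) = ⊥-elim (distinct l₁<l₂ e₁ p₁ e₂ p₂)
    first (inj₂ (e₁ , p₁)) (inj₁ e₂)        = ⊥-elim (l₁≢z₁₀ (≡.trans e₁ (proj₂ (wraps l₁<l₂ e₁ e₂)) , p₁))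
    s₁≡s : side l₁ ≡ s
    s₁≡s = first on₁ on₂
    second : OnSide s l₂ → OnSide s l₃ → side l₂ ≡ s
    second (inj₁ e)         _                = e
    second (inj₂ (e₂ , p₂)) (inj₂ (e₃ , p₃)) = ⊥-elim (distinct l₂<l₃ e₂ p₂ e₃ p₃)
    second (inj₂ (e₂ , _))  (inj₁ e₃)        = ⊥-elim (ℕ.<-irrefl ≡.refl (ℕ.<-≤-trans 1<s₁ s₁≤1))
      where
      last : (s ≡ k) × (next s ≡ 1)
      last = wraps l₂<l₃ e₂ e₃
      1<s₁ : 1 ℕ.< side l₁
      1<s₁ = ℕ.<-≤-trans (ℕ.≤-trans (s≤s (s≤s z≤n)) 3≤k) (ℕ.≤-reflexive (≡.sym (≡.trans s₁≡s (proj₁ last))))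
      s₁≤1 : side l₁ ℕ.≤ 1
      s₁≤1 = ℕ.≤-trans (<L⇒side≤ l₁<l₂) (ℕ.≤-reflexive (≡.trans e₂ (proj₂ last)))
    s₂≡s : side l₂ ≡ s
    s₂≡s = second on₂ on₃
    third : OnSide s l₃ → ((side l₃ ≡ s) × (pos l₂ ℕ.< pos l₃)) ⊎ ((side l₃ ≡ next s) × (pos l₃ ≡ 0))
    third (inj₁ e)      = inj₁ (e , <L-sameSide⇒pos< l₂<l₃ (≡.trans s₂≡s (≡.sym e)))
    third (inj₂ at-end) = inj₂ at-end
    l₃-after : ((side l₃ ≡ s) × (pos l₂ ℕ.< pos l₃)) ⊎ ((side l₃ ≡ next s) × (pos l₃ ≡ 0))
    l₃-after = third on₃

  chords-meet : ∀ {p q r s} → p <L q → q <L r → r <L s →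
    (OnCommonSide p q r → Segment (pt p) (pt r) (pt q)) →
    Σ Point λ x → Segment (pt p) (pt r) x × Segment (pt q) (pt s) x
  chords-meet {p} {q} {r} {s} p<q q<r r<s collinear with proj₂ (convexPosition p<q q<r)
  ... | inj₂ common = pt q , collinear common , segment-start (pt q) (pt s)
  ... | inj₁ pqr>0  = segments-meet (pt p) (pt r) (pt q) (pt s) prq<0 prs≥0 qsp≥0 qsr≤0
    where
    prq<0 : orient (pt p) (pt r) (pt q) <F 0#
    prq<0 = <-respˡ-≈ (sym (orient-swap (pt p) (pt r) (pt q))) (pos⇒-neg pqr>0)
    prs≥0 : 0# ≤F orient (pt p) (pt r) (pt s)
    prs≥0 = orientL-nonNeg (<L-trans p<q q<r) r<s
    qsp≥0 : 0# ≤F orient (pt q) (pt s) (pt p)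
    qsp≥0 = ≤-respʳ-≈ (orient-rotate (pt p) (pt q) (pt s)) (orientL-nonNeg p<q (<L-trans q<r r<s))
    qsr≤0 : orient (pt q) (pt s) (pt r) ≤F 0#
    qsr≤0 = ≤-respˡ-≈ (sym (orient-swap (pt q) (pt s) (pt r))) (nonNeg⇒-nonPos (orientL-nonNeg q<r r<s))

  chord-separates : ∀ {ℓ u} {S T : Point → Set} → ℓ <L u →
    (∀ y → S y → Σ Lab λ l → (y ≈ₚ pt l) × ((l ≤L ℓ) ⊎ (u ≤L l))) →
    (∀ y → T y → Σ Lab λ l → (y ≈ₚ pt l) × (0# <F orientL ℓ l u)) →
    ∀ x → x ∈Conv S → x ∈Conv T → ⊥
  chord-separates {ℓ} {u} {S} {T} ℓ<u S-outside T-inside = separation (orientForm (pt u) (pt ℓ)) S≤0 T>0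
    where
    eval-chord : ∀ y l → y ≈ₚ pt l → eval (orientForm (pt u) (pt ℓ)) y ≈ orientL ℓ l u
    eval-chord y l y≈l = trans (eval-orientForm (pt u) (pt ℓ) y)
      (trans (orient-cong ≈ₚ-refl ≈ₚ-refl y≈l)
        (sym (trans (orient-rotate (pt ℓ) (pt l) (pt u)) (orient-rotate (pt l) (pt u) (pt ℓ)))))
    outside≤0 : ∀ l → (l ≤L ℓ) ⊎ (u ≤L l) → orientL ℓ l u ≤F 0#
    outside≤0 l (inj₁ (inj₂ ≡.refl)) = ≤-reflexive (orient-aab (pt l) (pt u))
    outside≤0 l (inj₁ (inj₁ l<ℓ))    =
      ≤-respˡ-≈ (sym (trans (orient-rotate (pt ℓ) (pt l) (pt u)) (orient-swap (pt l) (pt u) (pt ℓ))))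
        (nonNeg⇒-nonPos (orientL-nonNeg l<ℓ ℓ<u))
    outside≤0 l (inj₂ (inj₂ ≡.refl)) = ≤-reflexive (orient-abb (pt ℓ) (pt l))
    outside≤0 l (inj₂ (inj₁ u<l))    =
      ≤-respˡ-≈ (sym (orient-swap (pt ℓ) (pt l) (pt u))) (nonNeg⇒-nonPos (orientL-nonNeg ℓ<u u<l))
    S≤0 : ∀ y → S y → eval (orientForm (pt u) (pt ℓ)) y ≤F 0#
    S≤0 y Sy with S-outside y Sy
    ... | l , y≈l , outside = ≤-respˡ-≈ (sym (eval-chord y l y≈l)) (outside≤0 l outside)
    T>0 : ∀ y → T y → 0# <F eval (orientForm (pt u) (pt ℓ)) y
    T>0 y Ty with T-inside y Ty
    ... | l , y≈l , inside = <-respʳ-≈ (sym (eval-chord y l y≈l)) inside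

module SpecialLabels (k : ℕ) (c : ℕ → ℕ) (3≤k : 3 ℕ.≤ k) (c₁≡0 : c 1 ≡ 0) where

  open Labels k c

  z₁₀ : Lab
  z₁₀ = z10 3≤k

  zₖ : Lab
  zₖ = zkck 3≤k

  z₂₀ : Lab
  z₂₀ = 2 , 0 , (s≤s z≤n , ℕ.≤-trans (s≤s (s≤s z≤n)) 3≤k) , z≤n

  is10? : ∀ (l : Lab) → Dec (Is10 l)
  is10? l with side l ℕ.≟ 1 | pos l ℕ.≟ 0
  ... | yes s≡1 | yes p≡0 = yes (s≡1 , p≡0)
  ... | no s≢1  | _       = no λ is10 → s≢1 (proj₁ is10)
  ... | yes _   | no p≢0  = no λ is10 → p≢0 (proj₂ is10)

  Is10⇒≡z₁₀ : ∀ {l} → Is10 l → l ≡ z₁₀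
  Is10⇒≡z₁₀ {l} (s≡1 , p≡0) = label-≡ l z₁₀ s≡1 p≡0

  z₁₀-is10 : Is10 z₁₀
  z₁₀-is10 = ≡.refl , ≡.refl

  zₖ-not10 : ¬ Is10 zₖ
  zₖ-not10 (k≡1 , _) = ℕ.<-irrefl (≡.sym k≡1) (ℕ.≤-trans (s≤s (s≤s z≤n)) 3≤k)

  z₂₀-not10 : ¬ Is10 z₂₀
  z₂₀-not10 (() , _)

  -- Side 1 is blank, so z_{1,0} is the only label on it.
  not10⇒2≤side : ∀ (l : Lab) → ¬ Is10 l → 2 ℕ.≤ side l
  not10⇒2≤side (suc zero , j , _ , j≤c) l≢z₁₀ =
    ⊥-elim (l≢z₁₀ (≡.refl , ℕ.n≤0⇒n≡0 (≡.subst (j ℕ.≤_) c₁≡0 j≤c)))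
  not10⇒2≤side (suc (suc i) , _) _ = s≤s (s≤s z≤n)

  z₁₀-least : ∀ l → ¬ Is10 l → z₁₀ <L l
  z₁₀-least l l≢z₁₀ = side< (not10⇒2≤side l l≢z₁₀)

  z₂₀-least : ∀ l → ¬ Is10 l → z₂₀ ≤L l
  z₂₀-least l l≢z₁₀ with ℕ.m≤n⇒m<n∨m≡n (not10⇒2≤side l l≢z₁₀) | pos l ℕ.≟ 0
  ... | inj₁ 2<s    | _       = inj₁ (side< 2<s)
  ... | inj₂ 2≡s    | yes p≡0 = inj₂ (label-≡ z₂₀ l 2≡s (≡.sym p≡0))
  ... | inj₂ 2≡s    | no p≢0  = inj₁ (pos< 2≡s (ℕ.n≢0⇒n>0 p≢0))

  zₖ-greatest : ∀ l → l ≤L zₖ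
  zₖ-greatest l@(i , j , (_ , i≤k) , j≤c) with ℕ.m≤n⇒m<n∨m≡n i≤k
  ... | inj₁ i<k    = inj₁ (side< i<k)
  ... | inj₂ ≡.refl with ℕ.m≤n⇒m<n∨m≡n j≤c
  ...   | inj₁ j<c = inj₁ (pos< ≡.refl j<c)
  ...   | inj₂ j≡c = inj₂ (label-≡ l zₖ ≡.refl j≡c)

  At : ℕ → ℕ → Lab → Set
  At i j l = (side l ≡ i) × (pos l ≡ j)

  isLabelᵇ-sound : ∀ {i j} l → isLabelᵇ i j l ≡ true → At i j l
  isLabelᵇ-sound l e with Equivalence.to Bool.T-∧ (≡true⇒T e)
  ... | s≡ᵇi , p≡ᵇj = ℕ.≡ᵇ⇒≡ _ _ s≡ᵇi , ℕ.≡ᵇ⇒≡ _ _ p≡ᵇj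

  isLabelᵇ-complete : ∀ {i j} l → At i j l → isLabelᵇ i j l ≡ true
  isLabelᵇ-complete l (s≡i , p≡j) = T⇒≡true (Equivalence.from Bool.T-∧ (ℕ.≡⇒≡ᵇ _ _ s≡i , ℕ.≡⇒≡ᵇ _ _ p≡j))

  α-z₁₀ : ∀ {i j} l → At i j l → αrel i j z₁₀ l ≡ true
  α-z₁₀ l at rewrite isLabelᵇ-complete l at = Bool.∨-zeroʳ _

  α-sound : ∀ {i j} l l′ → αrel i j l l′ ≡ true → (l ≡ l′) ⊎ (Is10 l × At i j l′) ⊎ (At i j l × Is10 l′)
  α-sound l l′ e with Equivalence.to Bool.T-∨ (≡true⇒T e)
  ... | inj₁ same = inj₁ (label-≡ l l′ (proj₁ at) (proj₂ at))
    where
    at : At (side l′) (pos l′) l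
    at = isLabelᵇ-sound l (T⇒≡true same)
  ... | inj₂ pair with Equivalence.to Bool.T-∨ pair
  ...   | inj₁ z₁₀-first  = let (a , b) = Equivalence.to Bool.T-∧ z₁₀-first
                            in inj₂ (inj₁ (isLabelᵇ-sound l (T⇒≡true a) , isLabelᵇ-sound l′ (T⇒≡true b)))
  ...   | inj₂ z₁₀-second = let (a , b) = Equivalence.to Bool.T-∧ z₁₀-second
                            in inj₂ (inj₂ (isLabelᵇ-sound l (T⇒≡true a) , isLabelᵇ-sound l′ (T⇒≡true b)))

  InArc : ℕ → ℕ → Lab → Set
  InArc i j l = (side l ℕ.< i) ⊎ ((side l ≡ i) × (pos l ℕ.≤ j))

  InArc⇒≤L : ∀ m l → InArc (side m) (pos m) l → l ≤L m
  InArc⇒≤L m l (inj₁ s<) = inj₁ (side< s<)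
  InArc⇒≤L m l (inj₂ (s≡ , p≤)) with ℕ.m≤n⇒m<n∨m≡n p≤
  ... | inj₁ p< = inj₁ (pos< s≡ p<)
  ... | inj₂ p≡ = inj₂ (label-≡ l m s≡ p≡)

  ¬InArc⇒>L : ∀ m l → ¬ InArc (side m) (pos m) l → m <L l
  ¬InArc⇒>L m l l∉arc with <L-trichotomy m l
  ... | inj₁ m<l                   = m<l
  ... | inj₂ (inj₁ ≡.refl)         = ⊥-elim (l∉arc (inj₂ (≡.refl , ℕ.≤-refl)))
  ... | inj₂ (inj₂ (side< s<))     = ⊥-elim (l∉arc (inj₁ s<))
  ... | inj₂ (inj₂ (pos< s≡ p<))   = ⊥-elim (l∉arc (inj₂ (s≡ , ℕ.<⇒≤ p<)))

  inArcᵇ-sound : ∀ {i j} l → inArcᵇ i j l ≡ true → InArc i j l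
  inArcᵇ-sound l e with Equivalence.to Bool.T-∨ (≡true⇒T e)
  ... | inj₁ s<i  = inj₁ (ℕ.<ᵇ⇒< _ _ s<i)
  ... | inj₂ s≡∧p≤ with Equivalence.to Bool.T-∧ s≡∧p≤
  ...   | s≡i , p≤j = inj₂ (ℕ.≡ᵇ⇒≡ _ _ s≡i , ℕ.≤ᵇ⇒≤ _ _ p≤j)

  inArcᵇ-complete : ∀ {i j} l → InArc i j l → inArcᵇ i j l ≡ true
  inArcᵇ-complete {i} {j} l arc = T⇒≡true (Equivalence.from Bool.T-∨ (mk arc))
    where
    mk : InArc i j l → T (side l <ᵇ i) ⊎ T ((side l ≡ᵇ i) ∧ (pos l ≤ᵇ j))
    mk (inj₁ s<i)         = inj₁ (ℕ.<⇒<ᵇ s<i)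
    mk (inj₂ (s≡i , p≤j)) = inj₂ (Equivalence.from Bool.T-∧ (ℕ.≡⇒≡ᵇ _ _ s≡i , ℕ.≤⇒≤ᵇ p≤j))

  i≤k∸1⇒i<k : ∀ {i} → i ℕ.≤ k ∸ 1 → i ℕ.< k
  i≤k∸1⇒i<k = m≤n∸1⇒m<n (ℕ.≤-trans (s≤s z≤n) 3≤k)

  label : ∀ i j → 2 ℕ.≤ i → i ℕ.≤ k ∸ 1 → j ℕ.≤ c i → Lab
  label i j 2≤i i≤k∸1 j≤c = i , j , (ℕ.≤-trans (s≤s z≤n) 2≤i , ℕ.<⇒≤ (i≤k∸1⇒i<k i≤k∸1)) , j≤c

  Interval : ℕ → ℕ → (Lab → Lab → Bool) → Set
  Interval i j R = (αrel i j ⊑ R) × (R ⊑ βrel i j)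

  β-sameArc : ∀ {i j} {R : Lab → Lab → Bool} → R ⊑ βrel i j → ∀ l l′ → R l l′ ≡ true → inArcᵇ i j l ≡ inArcᵇ i j l′
  β-sameArc R⊑β l l′ e = not-xor⇒≡ _ _ (R⊑β l l′ e)

  module _ (R : Partition Lab) where

    z₁₀∼label : ∀ {i j} (2≤i : 2 ℕ.≤ i) (i≤k∸1 : i ℕ.≤ k ∸ 1) (j≤c : j ℕ.≤ c i) →
      αrel i j ⊑ rel R → rel R z₁₀ (label i j 2≤i i≤k∸1 j≤c) ≡ true
    z₁₀∼label {i} {j} 2≤i i≤k∸1 j≤c α⊑R = α⊑R z₁₀ m (α-z₁₀ m (≡.refl , ≡.refl))
      where
      m : Lab
      m = label i j 2≤i i≤k∸1 j≤c

    interval-z₁₀-notSingleton : ∀ {i j} → 2 ℕ.≤ i → i ℕ.≤ k ∸ 1 → j ℕ.≤ c i → Interval i j (rel R) →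
      ¬ (∀ l → rel R z₁₀ l ≡ true → Is10 l)
    interval-z₁₀-notSingleton 2≤i i≤k∸1 j≤c (α⊑R , _) singleton =
      ℕ.<-irrefl (≡.sym (proj₁ (singleton _ (z₁₀∼label 2≤i i≤k∸1 j≤c α⊑R)))) 2≤i

    interval-z₁₀≁zₖ : ∀ {i j} → 2 ℕ.≤ i → i ℕ.≤ k ∸ 1 → Interval i j (rel R) → ¬ (rel R z₁₀ zₖ ≡ true)
    interval-z₁₀≁zₖ {i} {j} 2≤i i≤k∸1 (_ , R⊑β) z₁₀∼zₖ with inArcᵇ-sound {i} {j} zₖ
      (≡.trans (≡.sym (β-sameArc R⊑β z₁₀ zₖ z₁₀∼zₖ)) (inArcᵇ-complete {i} {j} z₁₀ (inj₁ 2≤i)))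
    ... | inj₁ k<i       = ℕ.<-asym k<i (i≤k∸1⇒i<k i≤k∸1)
    ... | inj₂ (k≡i , _) = ℕ.<-irrefl (≡.sym k≡i) (i≤k∸1⇒i<k i≤k∸1)

    interval-unique : ∀ {i j i′ j′} (2≤i : 2 ℕ.≤ i) (i≤k∸1 : i ℕ.≤ k ∸ 1) (j≤c : j ℕ.≤ c i)
      (2≤i′ : 2 ℕ.≤ i′) (i′≤k∸1 : i′ ℕ.≤ k ∸ 1) (j′≤c′ : j′ ℕ.≤ c i′) →
      Interval i j (rel R) → Interval i′ j′ (rel R) → (i ≡ i′) × (j ≡ j′)
    interval-unique {i} {j} {i′} {j′} 2≤i i≤k∸1 j≤c 2≤i′ i′≤k∸1 j′≤c′ (α⊑R , R⊑β) (α′⊑R , R⊑β′) =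
      compare (arc-of m′ R⊑β m m∼m′ (≡.refl , ≡.refl)) (arc-of m R⊑β′ m′ (rel-sym R m m′ m∼m′) (≡.refl , ≡.refl))
      where
      m m′ : Lab
      m = label i j 2≤i i≤k∸1 j≤c
      m′ = label i′ j′ 2≤i′ i′≤k∸1 j′≤c′
      m∼m′ : rel R m m′ ≡ true
      m∼m′ = rel-trans R m z₁₀ m′ (rel-sym R z₁₀ m (z₁₀∼label 2≤i i≤k∸1 j≤c α⊑R))
               (z₁₀∼label 2≤i′ i′≤k∸1 j′≤c′ α′⊑R)
      arc-of : ∀ {a b} l′ → rel R ⊑ βrel a b → ∀ l → rel R l l′ ≡ true → At a b l → InArc a b l′
      arc-of l′ R⊑βab l l∼l′ (s≡a , p≡b) =
        inArcᵇ-sound l′ (≡.trans (≡.sym (β-sameArc R⊑βab l l′ l∼l′))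
                                 (inArcᵇ-complete l (inj₂ (s≡a , ℕ.≤-reflexive p≡b))))
      compare : InArc i j m′ → InArc i′ j′ m → (i ≡ i′) × (j ≡ j′)
      compare (inj₁ i′<i)       (inj₁ i<i′)       = ⊥-elim (ℕ.<-asym i′<i i<i′)
      compare (inj₁ i′<i)       (inj₂ (i≡i′ , _)) = ⊥-elim (ℕ.<-irrefl (≡.sym i≡i′) i′<i)
      compare (inj₂ (i′≡i , _)) (inj₁ i<i′)       = ⊥-elim (ℕ.<-irrefl (≡.sym i′≡i) i<i′)
      compare (inj₂ (_ , j′≤j)) (inj₂ (i≡i′ , j≤j′)) = i≡i′ , ℕ.≤-antisym j≤j′ j′≤j

module Separation (F : OrderedField) (k : ℕ) (c : ℕ → ℕ)
  (z : ℕ → ℕ → Geometry.Point F) (t : ℕ → ℕ → OrderedField.Carrier F)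
  (3≤k : 3 ℕ.≤ k) (c₁≡0 : c 1 ≡ 0)
  (convex : Geometry.ConvexCCW F k z) (onSides : Geometry.SidePoints F k c z t) where

  open ConvexPolygon F k c z t 3≤k convex onSides public
  open PlaneGeometry F public
  open Labels k c public
  open SpecialLabels k c 3≤k c₁≡0 public

  Points : (Lab → Set) → Point → Set
  Points Q y = Σ Lab λ l → Q l × (y ≈ₚ pt l)

  segment⇒∈ConvPoints : ∀ {Q : Lab → Set} {l₁ l₂ x} → Q l₁ → Q l₂ → Segment (pt l₁) (pt l₂) x → x ∈Conv Points Q
  segment⇒∈ConvPoints {Q} {l₁} {l₂} q₁ q₂ seg =
    segment⇒∈Conv {Points Q} seg (l₁ , q₁ , ≈ₚ-refl {pt l₁}) (l₂ , q₂ , ≈ₚ-refl {pt l₂})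

  k-isSide : IsSide k
  k-isSide = 1≤k , ℕ.≤-refl

  z₁₀-onSide-k : OnSide k z₁₀
  z₁₀-onSide-k = inj₂ (≡.sym next-k , ≡.refl)

  -- z_{1,0} is a vertex: edge 1 + edge k vanishes there and is positive at every other point of P.
  z₁₀-apart : ∀ {Q : Lab → Set} → (∀ l → Q l → ¬ Is10 l) →
    ∀ x → x ∈Conv (_≈ₚ pt z₁₀) → x ∈Conv Points Q → ⊥
  z₁₀-apart {Q} Q-not10 = separation g z₁₀≤0 Q>0
    where
    1-isSide : IsSide 1
    1-isSide = ℕ.≤-refl , 1≤k
    g : AffineForm
    g = orientForm (V 1) (V (next 1)) ⊕ orientForm (V k) (V (next k))
    eval-g : ∀ y → eval g y ≈ edge 1 y + edge k y
    eval-g y = trans (eval-⊕ _ _ y) (+-cong (eval-orientForm (V 1) (V (next 1)) y) (eval-orientForm (V k) (V (next k)) y))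
    z₁₀≤0 : ∀ y → y ≈ₚ pt z₁₀ → eval g y ≤F 0#
    z₁₀≤0 y y≈z₁₀ = ≤-reflexive (trans (eval-g y)
      (trans (+-cong (trans (edge-cong 1 y≈z₁₀) (edge-zero z₁₀ (inj₁ ≡.refl)))
                     (trans (edge-cong k y≈z₁₀) (edge-zero z₁₀ z₁₀-onSide-k)))
             (+-identityʳ 0#)))
    next-1 : next 1 ≡ 2
    next-1 = next-<k (ℕ.≤-trans (s≤s (s≤s z≤n)) 3≤k)
    others>0 : ∀ l → ¬ Is10 l → 0# <F edge 1 (pt l) + edge k (pt l)
    others>0 l l≢z₁₀ with edge-pos-or-onSide 1-isSide l | edge-pos-or-onSide k-isSide l
    ... | inj₁ e₁>0 | _ = pos+nonNeg⇒pos e₁>0 (edge-nonNeg k-isSide l)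
    ... | _ | inj₁ eₖ>0 = nonNeg+pos⇒pos (edge-nonNeg 1-isSide l) eₖ>0
    ... | inj₂ (inj₁ s≡1) | _ = ⊥-elim (ℕ.<-irrefl (≡.sym s≡1) (not10⇒2≤side l l≢z₁₀))
    ... | inj₂ (inj₂ (s≡2 , _)) | inj₂ (inj₁ s≡k) =
      ⊥-elim (ℕ.<-irrefl (≡.trans (≡.sym (≡.trans s≡2 next-1)) s≡k) 3≤k)
    ... | inj₂ (inj₂ (s≡2 , _)) | inj₂ (inj₂ (s≡1 , _)) =
      ⊥-elim (ℕ.<-irrefl (≡.trans (≡.sym (≡.trans s≡1 next-k)) (≡.trans s≡2 next-1)) (s≤s (s≤s z≤n)))
    Q>0 : ∀ y → Points Q y → 0# <F eval g y
    Q>0 y (l , q , y≈l) = <-respʳ-≈ (sym (trans (eval-g y) (+-cong (edge-cong 1 y≈l) (edge-cong k y≈l)))) (others>0 l (Q-not10 l q))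

  z₁₀-notOnCommonSide : ∀ {l m} → z₁₀ <L l → l <L m → side m ≢ k → ¬ OnCommonSide z₁₀ l m
  z₁₀-notOnCommonSide {l} {m} z₁₀<l l<m m∉k (s , rs , on₁ , onₗ , onₘ) with on₁
  ... | inj₁ 1≡s = excluded onₗ onₘ
    where
    2≤l : 2 ℕ.≤ side l
    2≤l = not10⇒2≤side l (λ is10 → <L-irrefl (≡.subst (z₁₀ <L_) (Is10⇒≡z₁₀ is10) z₁₀<l))
    2≤m : 2 ℕ.≤ side m
    2≤m = ℕ.≤-trans 2≤l (<L⇒side≤ l<m)
    excluded : OnSide s l → OnSide s m → ⊥
    excluded _ (inj₁ e)                  = ℕ.<-irrefl (≡.trans 1≡s (≡.sym e)) 2≤m
    excluded (inj₁ e) (inj₂ _)           = ℕ.<-irrefl (≡.trans 1≡s (≡.sym e)) 2≤l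
    excluded (inj₂ (e , p)) (inj₂ (e′ , p′)) =
      <L-irrefl (≡.subst (l <L_) (label-≡ m l (≡.trans e′ (≡.sym e)) (≡.trans p′ (≡.sym p))) l<m)
  ... | inj₂ (1≡next , _) with next-cases rs
  ...   | inj₁ (_ , e) = ℕ.<-irrefl (≡.trans 1≡next e) (s≤s (proj₁ rs))
  ...   | inj₂ (s≡k , e) = excluded onₘ
    where
    2≤m : 2 ℕ.≤ side m
    2≤m = not10⇒2≤side m (λ is10 → <L-irrefl (≡.subst (z₁₀ <L_) (Is10⇒≡z₁₀ is10) (<L-trans z₁₀<l l<m)))
    excluded : OnSide s m → ⊥
    excluded (inj₁ e′)     = m∉k (≡.trans e′ s≡k)
    excluded (inj₂ (a , _)) = ℕ.<-irrefl (≡.sym (≡.trans a e)) 2≤m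

  WithZ₁₀ : (Lab → Set) → Point → Set
  WithZ₁₀ Q y = (y ≈ₚ pt z₁₀) ⊎ Points Q y

  module AdjoinZ₁₀ (inB inC : Lab → Set) (inB? : ∀ l → Dec (inB l)) (inC? : ∀ l → Dec (inC l))
    (B-not10 : ∀ l → inB l → ¬ Is10 l) (C-not10 : ∀ l → inC l → ¬ Is10 l) (B∩C=∅ : ∀ l → inB l → inC l → ⊥)
    (zₖ∈B : inB zₖ) {c₀ : Lab} (c₀∈C : inC c₀)
    (B-C-apart : ∀ x → x ∈Conv Points inB → x ∈Conv Points inC → ⊥) where

    private
      abstract
        C-least : Least inC
        C-least = least inC inC? c₀∈C

        C-greatest : Greatest inC
        C-greatest = greatest inC inC? c₀∈C

      cmin : Lab
      cmin = proj₁ C-least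

      cmin∈C : inC cmin
      cmin∈C = proj₁ (proj₂ C-least)

      cmin≤ : ∀ l → inC l → cmin ≤L l
      cmin≤ = proj₂ (proj₂ C-least)

      cmax : Lab
      cmax = proj₁ C-greatest

      cmax∈C : inC cmax
      cmax∈C = proj₁ (proj₂ C-greatest)

      ≤cmax : ∀ l → inC l → l ≤L cmax
      ≤cmax = proj₂ (proj₂ C-greatest)

      cmax<zₖ : cmax <L zₖ
      cmax<zₖ with zₖ-greatest cmax
      ... | inj₁ lt      = lt
      ... | inj₂ cmax≡zₖ = ⊥-elim (B∩C=∅ zₖ zₖ∈B (≡.subst inC cmax≡zₖ cmax∈C))

      -- A point of B strictly inside the range of C would make the chords cmin–cmax and l–zₖ cross.
      B-outside : ∀ l → inB l → (l <L cmin) ⊎ (cmax <L l)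
      B-outside l l∈B with <L-trichotomy l cmin
      ... | inj₁ l<cmin         = inj₁ l<cmin
      ... | inj₂ (inj₁ ≡.refl)  = ⊥-elim (B∩C=∅ l l∈B cmin∈C)
      ... | inj₂ (inj₂ cmin<l) with <L-trichotomy l cmax
      ...   | inj₂ (inj₂ cmax<l) = inj₂ cmax<l
      ...   | inj₂ (inj₁ ≡.refl) = ⊥-elim (B∩C=∅ l l∈B cmax∈C)
      ...   | inj₁ l<cmax = ⊥-elim (B-C-apart x (segment⇒∈ConvPoints l∈B zₖ∈B on-B) (segment⇒∈ConvPoints cmin∈C cmax∈C on-C))
        where
        meet : Σ Point λ x → Segment (pt cmin) (pt cmax) x × Segment (pt l) (pt zₖ) x
        meet = chords-meet cmin<l l<cmax cmax<zₖ (between-onCommonSide cmin<l l<cmax (C-not10 cmin cmin∈C))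
        x : Point
        x = proj₁ meet
        on-C : Segment (pt cmin) (pt cmax) x
        on-C = proj₁ (proj₂ meet)
        on-B : Segment (pt l) (pt zₖ) x
        on-B = proj₂ (proj₂ meet)

      Above : Lab → Set
      Above l = inB l × (cmax <L l)

      Above? : ∀ l → Dec (Above l)
      Above? l with inB? l | cmax <L? l
      ... | yes l∈B | yes cmax<l = yes (l∈B , cmax<l)
      ... | no l∉B  | _          = no λ above → l∉B (proj₁ above)
      ... | yes _   | no cmax≮l  = no λ above → cmax≮l (proj₂ above)

      Below : Lab → Set
      Below l = inB l × (l <L cmin)

      Below? : ∀ l → Dec (Below l)
      Below? l with inB? l | l <L? cmin
      ... | yes l∈B | yes l<cmin = yes (l∈B , l<cmin)
      ... | no l∉B  | _          = no λ below → l∉B (proj₁ below)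
      ... | yes _   | no l≮cmin  = no λ below → l≮cmin (proj₂ below)

      abstract
        B-above : Least Above
        B-above = least Above Above? (zₖ∈B , cmax<zₖ)

      bhi : Lab
      bhi = proj₁ B-above

      bhi∈B : inB bhi
      bhi∈B = proj₁ (proj₁ (proj₂ B-above))

      bhi≤ : ∀ l → Above l → bhi ≤L l
      bhi≤ = proj₂ (proj₂ B-above)

      cmax<bhi : cmax <L bhi
      cmax<bhi = proj₂ (proj₁ (proj₂ B-above))

      C<bhi : ∀ l → inC l → l <L bhi
      C<bhi l l∈C = ≤L-<L-trans (≤cmax l l∈C) cmax<bhi

      inside-strictly : ∀ {ℓ} → inB ℓ → ¬ Is10 ℓ → ∀ l → inC l → ℓ <L l → 0# <F orientL ℓ l bhi
      inside-strictly {ℓ} ℓ∈B ℓ≢z₁₀ l l∈C ℓ<l with proj₂ (convexPosition ℓ<l (C<bhi l l∈C))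
      ... | inj₁ 0<O   = 0<O
      ... | inj₂ common = ⊥-elim (B-C-apart (pt l)
            (segment⇒∈ConvPoints ℓ∈B bhi∈B (between-onCommonSide ℓ<l (C<bhi l l∈C) ℓ≢z₁₀ common))
            (∈⇒∈Conv {Points inC} (l , l∈C , ≈ₚ-refl {pt l})))

      apart-with-B-below : ∀ blo → inB blo → blo <L cmin → (∀ l → Below l → l ≤L blo) →
        ∀ x → x ∈Conv WithZ₁₀ inB → x ∈Conv Points inC → ⊥
      apart-with-B-below blo blo∈B blo<cmin ≤blo = chord-separates blo<bhi outside inside
        where
        blo<bhi : blo <L bhi
        blo<bhi = <L-trans (<L-≤L-trans blo<cmin (cmin≤ cmax cmax∈C)) cmax<bhi
        outside : ∀ y → WithZ₁₀ inB y → Σ Lab λ l → (y ≈ₚ pt l) × ((l ≤L blo) ⊎ (bhi ≤L l))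
        outside y (inj₁ y≈z₁₀) = z₁₀ , y≈z₁₀ , inj₁ (inj₁ (z₁₀-least blo (B-not10 blo blo∈B)))
        outside y (inj₂ (l , l∈B , y≈l)) with B-outside l l∈B
        ... | inj₁ l<cmin = l , y≈l , inj₁ (≤blo l (l∈B , l<cmin))
        ... | inj₂ cmax<l = l , y≈l , inj₂ (bhi≤ l (l∈B , cmax<l))
        inside : ∀ y → Points inC y → Σ Lab λ l → (y ≈ₚ pt l) × (0# <F orientL blo l bhi)
        inside y (l , l∈C , y≈l) =
          l , y≈l , inside-strictly blo∈B (B-not10 blo blo∈B) l l∈C (<L-≤L-trans blo<cmin (cmin≤ l l∈C))

      module NoneBelow (none-below : ∀ l → ¬ Below l) where

        bhi-least : ∀ l → inB l → bhi ≤L l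
        bhi-least l l∈B with B-outside l l∈B
        ... | inj₁ l<cmin = ⊥-elim (none-below l (l∈B , l<cmin))
        ... | inj₂ cmax<l = bhi≤ l (l∈B , cmax<l)

        apart-off-side-k : side bhi ≢ k → ∀ x → x ∈Conv WithZ₁₀ inB → x ∈Conv Points inC → ⊥
        apart-off-side-k bhi∉k = chord-separates (z₁₀-least bhi (B-not10 bhi bhi∈B)) outside inside
          where
          outside : ∀ y → WithZ₁₀ inB y → Σ Lab λ l → (y ≈ₚ pt l) × ((l ≤L z₁₀) ⊎ (bhi ≤L l))
          outside y (inj₁ y≈z₁₀)         = z₁₀ , y≈z₁₀ , inj₁ (inj₂ ≡.refl)
          outside y (inj₂ (l , l∈B , y≈l)) = l , y≈l , inj₂ (bhi-least l l∈B)
          inside : ∀ y → Points inC y → Σ Lab λ l → (y ≈ₚ pt l) × (0# <F orientL z₁₀ l bhi)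
          inside y (l , l∈C , y≈l) with proj₂ (convexPosition (z₁₀-least l (C-not10 l l∈C)) (C<bhi l l∈C))
          ... | inj₁ 0<O    = l , y≈l , 0<O
          ... | inj₂ common = ⊥-elim (z₁₀-notOnCommonSide (z₁₀-least l (C-not10 l l∈C)) (C<bhi l l∈C) bhi∉k common)

        -- Here B ∪ {z₁₀} lies on the segment from bhi to z₁₀ of side k and C lies before bhi;
        -- edge k + orient(z₂₀, ·, bhi) separates them.
        apart-on-side-k : side bhi ≡ k → ∀ x → x ∈Conv WithZ₁₀ inB → x ∈Conv Points inC → ⊥
        apart-on-side-k bhi∈k = separation g adjoined≤0 C>0
          where
          g : AffineForm
          g = orientForm (V k) (V (next k)) ⊕ orientForm (pt bhi) (pt z₂₀)
          H : Lab → Carrier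
          H l = orientL z₂₀ l bhi
          eval-g : ∀ y l → y ≈ₚ pt l → eval g y ≈ edge k (pt l) + H l
          eval-g y l y≈l = trans (eval-⊕ _ _ y) (+-cong
            (trans (eval-orientForm (V k) (V (next k)) y) (edge-cong k y≈l))
            (trans (eval-orientForm (pt bhi) (pt z₂₀) y) (trans (orient-cong ≈ₚ-refl ≈ₚ-refl y≈l)
              (sym (trans (orient-rotate (pt z₂₀) (pt l) (pt bhi)) (orient-rotate (pt l) (pt bhi) (pt z₂₀)))))))
          z₂₀<bhi : z₂₀ <L bhi
          z₂₀<bhi = side< (≡.subst (2 ℕ.<_) (≡.sym bhi∈k) 3≤k)
          H≤0 : ∀ l → (l ≡ z₁₀) ⊎ (bhi ≤L l) → H l ≤F 0#
          H≤0 l (inj₁ ≡.refl) =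
            ≤-respˡ-≈ (sym (trans (orient-rotate (pt z₂₀) (pt z₁₀) (pt bhi)) (orient-swap (pt z₁₀) (pt bhi) (pt z₂₀))))
              (nonNeg⇒-nonPos (orientL-nonNeg (z₁₀-least z₂₀ z₂₀-not10) z₂₀<bhi))
          H≤0 l (inj₂ (inj₂ ≡.refl)) = ≤-reflexive (orient-abb (pt z₂₀) (pt bhi))
          H≤0 l (inj₂ (inj₁ bhi<l))  =
            ≤-respˡ-≈ (sym (orient-swap (pt z₂₀) (pt l) (pt bhi))) (nonNeg⇒-nonPos (orientL-nonNeg z₂₀<bhi bhi<l))
          far-point≤0 : ∀ l → OnSide k l → (l ≡ z₁₀) ⊎ (bhi ≤L l) → edge k (pt l) + H l ≤F 0#
          far-point≤0 l on-k far = ≤-respˡ-≈ (sym (+-cong (edge-zero l on-k) refl)) (≤-respˡ-≈ (sym (+-identityˡ _)) (H≤0 l far))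
          adjoined≤0 : ∀ y → WithZ₁₀ inB y → eval g y ≤F 0#
          adjoined≤0 y (inj₁ y≈z₁₀) =
            ≤-respˡ-≈ (sym (eval-g y z₁₀ y≈z₁₀)) (far-point≤0 z₁₀ z₁₀-onSide-k (inj₁ ≡.refl))
          adjoined≤0 y (inj₂ (l , l∈B , y≈l)) =
            ≤-respˡ-≈ (sym (eval-g y l y≈l)) (far-point≤0 l (inj₁ l∈k) (inj₂ (bhi-least l l∈B)))
            where
            l∈k : side l ≡ k
            l∈k = ℕ.≤-antisym (proj₂ (side-isSide l)) (≡.subst (ℕ._≤ side l) bhi∈k (≤L⇒side≤ (bhi-least l l∈B)))
          z₂₀∉k : ∀ {s} → s ≡ k → ¬ OnSide s z₂₀
          z₂₀∉k s≡k (inj₁ 2≡s)              = ℕ.<-irrefl (≡.trans 2≡s s≡k) 3≤k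
          z₂₀∉k ≡.refl (inj₂ (2≡next , _)) = ℕ.<-irrefl (≡.sym (≡.trans 2≡next next-k)) (s≤s (s≤s z≤n))
          C-point>0 : ∀ l → ¬ Is10 l → l <L bhi → z₂₀ ≤L l → 0# <F edge k (pt l) + H l
          C-point>0 l _ _ (inj₂ ≡.refl) with edge-pos-or-onSide k-isSide z₂₀
          ... | inj₁ 0<edge = <-respʳ-≈ (sym (+-cong refl (orient-aab (pt z₂₀) (pt bhi)))) (<-respʳ-≈ (sym (+-identityʳ _)) 0<edge)
          ... | inj₂ z₂₀∈k  = ⊥-elim (z₂₀∉k ≡.refl z₂₀∈k)
          C-point>0 l l≢z₁₀ l<bhi (inj₁ z₂₀<l) with edge-pos-or-onSide k-isSide l
          ... | inj₁ 0<edge = pos+nonNeg⇒pos 0<edge (orientL-nonNeg z₂₀<l l<bhi)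
          ... | inj₂ (inj₁ l∈k) =
            nonNeg+pos⇒pos (edge-nonNeg k-isSide l)
              (orientL-sameSide₂₃-pos z₂₀ l bhi l≡bhi-side (<L-sameSide⇒pos< l<bhi l≡bhi-side) (z₂₀∉k l∈k))
            where
            l≡bhi-side : side l ≡ side bhi
            l≡bhi-side = ≡.trans l∈k (≡.sym bhi∈k)
          ... | inj₂ (inj₂ (l∈1 , _)) = ⊥-elim (ℕ.<-irrefl (≡.sym (≡.trans l∈1 next-k)) (not10⇒2≤side l l≢z₁₀))
          C>0 : ∀ y → Points inC y → 0# <F eval g y
          C>0 y (l , l∈C , y≈l) =
            <-respʳ-≈ (sym (eval-g y l y≈l)) (C-point>0 l (C-not10 l l∈C) (C<bhi l l∈C) (z₂₀-least l (C-not10 l l∈C)))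

    -- Let bhi be the first point of B after C. If B also has points before C, the chord from
    -- the last of them to bhi separates; otherwise the chord from z₁₀ to bhi does, unless that
    -- chord runs along side k.
    still-apart : ∀ x → x ∈Conv WithZ₁₀ inB → x ∈Conv Points inC → ⊥
    still-apart with greatest? Below Below?
    ... | inj₁ (blo , (blo∈B , blo<cmin) , ≤blo) = apart-with-B-below blo blo∈B blo<cmin ≤blo
    ... | inj₂ none-below with side bhi ℕ.≟ k
    ...   | no bhi∉k  = NoneBelow.apart-off-side-k none-below bhi∉k
    ...   | yes bhi∈k = NoneBelow.apart-on-side-k none-below bhi∈k

module Intervals (F : OrderedField) (k : ℕ) (c : ℕ → ℕ)
  (z : ℕ → ℕ → Geometry.Point F) (t : ℕ → ℕ → OrderedField.Carrier F)
  (3≤k : 3 ℕ.≤ k) (c₁≡0 : c 1 ≡ 0)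
  (convex : Geometry.ConvexCCW F k z) (onSides : Geometry.SidePoints F k c z t) where

  open Separation F k c z t 3≤k c₁≡0 convex onSides

  NCP : Set
  NCP = NC Lab pt

  module _ (π : NCP) where

    private
      R : Lab → Lab → Bool
      R = rel (proj₁ π)

    InBlock₁₀ : Lab → Set
    InBlock₁₀ l = R z₁₀ l ≡ true

    -- If z₁₀ is joined to some m ≠ zₖ on side k, then zₖ lies between m and z₁₀.
    block₁₀-off-side-k : R z₁₀ zₖ ≡ false → ∀ m → InBlock₁₀ m → ¬ Is10 m → side m ≢ k
    block₁₀-off-side-k z₁₀≁zₖ m m∈ m≢z₁₀ m∈k =
      blocks-apart π z₁₀≁zₖ m∈ (rel-refl (proj₁ π) z₁₀) (rel-refl (proj₁ π) zₖ) (rel-refl (proj₁ π) zₖ)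
        (between-onSide k m zₖ z₁₀ m∈k ≡.refl m<cₖ (inj₂ (≡.sym next-k , ≡.refl))) (segment-start (pt zₖ) (pt zₖ))
      where
      m<cₖ : pos m ℕ.< c k
      m<cₖ with ℕ.m≤n⇒m<n∨m≡n (≡.subst (λ i → pos m ℕ.≤ c i) m∈k (pos≤c m))
      ... | inj₁ lt  = lt
      ... | inj₂ p≡c = ⊥-elim (≡false⇒≢true z₁₀≁zₖ (≡.subst InBlock₁₀ (label-≡ m zₖ m∈k p≡c) m∈))

    module _ (m : Lab) (m∈ : InBlock₁₀ m) (≤m : ∀ l → InBlock₁₀ l → l ≤L m)
             (m≢z₁₀ : ¬ Is10 m) (m<k : side m ℕ.< k) where

      private
        i j : ℕ
        i = side m
        j = pos m

      greatest-α⊑ : αrel i j ⊑ R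
      greatest-α⊑ l l′ l∼l′ with α-sound l l′ l∼l′
      ... | inj₁ ≡.refl                = rel-refl (proj₁ π) l
      ... | inj₂ (inj₁ (l≡z₁₀ , l′≡m)) =
        ≡.subst₂ (λ a b → R a b ≡ true) (≡.sym (Is10⇒≡z₁₀ l≡z₁₀))
          (label-≡ m l′ (≡.sym (proj₁ l′≡m)) (≡.sym (proj₂ l′≡m))) m∈
      ... | inj₂ (inj₂ (l≡m , l′≡z₁₀)) =
        ≡.subst₂ (λ a b → R a b ≡ true) (label-≡ m l (≡.sym (proj₁ l≡m)) (≡.sym (proj₂ l≡m)))
          (≡.sym (Is10⇒≡z₁₀ l′≡z₁₀))
          (rel-sym (proj₁ π) z₁₀ m m∈)

      -- A block leaving the arc z₁₀ … m either meets z₁₀'s block beyond m or crosses the chord z₁₀ m.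
      no-block-leaves-arc : ∀ l l′ → R l l′ ≡ true → l ≤L m → m <L l′ → ⊥
      no-block-leaves-arc l l′ l∼l′ l≤m m<l′ with R z₁₀ l Bool.≟ true
      ... | yes z₁₀∼l = ≤L⇒≯L (≤m l′ (rel-trans (proj₁ π) z₁₀ l l′ z₁₀∼l l∼l′)) m<l′
      ... | no z₁₀≁l  = blocks-apart π (Bool.¬-not z₁₀≁l) (rel-refl (proj₁ π) z₁₀) m∈ (rel-refl (proj₁ π) l) l∼l′
                          (proj₁ (proj₂ meet)) (proj₂ (proj₂ meet))
        where
        z₁₀<l : z₁₀ <L l
        z₁₀<l = z₁₀-least l λ l≡z₁₀ →
          z₁₀≁l (≡.subst InBlock₁₀ (≡.sym (Is10⇒≡z₁₀ l≡z₁₀)) (rel-refl (proj₁ π) z₁₀))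
        strict : l ≤L m → l <L m
        strict (inj₁ lt)     = lt
        strict (inj₂ ≡.refl) = ⊥-elim (z₁₀≁l m∈)
        l<m : l <L m
        l<m = strict l≤m
        meet : Σ Point λ x → Segment (pt z₁₀) (pt m) x × Segment (pt l) (pt l′) x
        meet = chords-meet z₁₀<l l<m m<l′ λ common → ⊥-elim (z₁₀-notOnCommonSide z₁₀<l l<m (ℕ.<⇒≢ m<k) common)

      arc-closed : ∀ l l′ → R l l′ ≡ true → inArcᵇ i j l ≡ true → inArcᵇ i j l′ ≡ true
      arc-closed l l′ l∼l′ l∈arc with inArcᵇ i j l′ in l′∈arc?
      ... | true  = ≡.refl
      ... | false = ⊥-elim (no-block-leaves-arc l l′ l∼l′ (InArc⇒≤L m l (inArcᵇ-sound l l∈arc))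
                      (¬InArc⇒>L m l′ λ arc → ≡false⇒≢true l′∈arc? (inArcᵇ-complete l′ arc)))

      greatest-⊑β : R ⊑ βrel i j
      greatest-⊑β l l′ l∼l′ = ≡⇒not-xor _ _ (Bool.⇔→≡ {z = true}
        (mk⇔ (arc-closed l l′ l∼l′) (arc-closed l′ l (rel-sym (proj₁ π) l l′ l∼l′))))

    X-or-interval : InX 3≤k z π ⊎ ∃₂ λ i j → (2 ℕ.≤ i × i ℕ.≤ k ∸ 1 × j ℕ.≤ c i) × InInterval z i j π
    X-or-interval with R z₁₀ zₖ Bool.≟ true
    ... | yes z₁₀∼zₖ = inj₁ (inj₂ z₁₀∼zₖ)
    ... | no z₁₀≁zₖ with greatest InBlock₁₀ (λ l → R z₁₀ l Bool.≟ true) (rel-refl (proj₁ π) z₁₀)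
    ...   | m , m∈ , ≤m with is10? m
    ...     | yes m≡z₁₀ = inj₁ (inj₁ singleton)
      where
      singleton : ∀ l → InBlock₁₀ l → Is10 l
      singleton l l∈ with is10? l
      ... | yes l≡z₁₀ = l≡z₁₀
      ... | no l≢z₁₀  = ⊥-elim (≤L⇒≯L (≡.subst (l ≤L_) (Is10⇒≡z₁₀ m≡z₁₀) (≤m l l∈)) (z₁₀-least l l≢z₁₀))
    ...     | no m≢z₁₀ =
      inj₂ (side m , pos m , (not10⇒2≤side m m≢z₁₀ , m<n⇒m≤n∸1 m<k , pos≤c m) ,
            greatest-α⊑ m m∈ ≤m m≢z₁₀ m<k , greatest-⊑β m m∈ ≤m m≢z₁₀ m<k)
      where
      m<k : side m ℕ.< k
      m<k = ℕ.≤∧≢⇒< (proj₂ (side-isSide m)) (block₁₀-off-side-k (Bool.¬-not z₁₀≁zₖ) m m∈ m≢z₁₀)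

  X-disjoint-interval : ∀ (π : NCP) i j → 2 ℕ.≤ i → i ℕ.≤ k ∸ 1 → j ℕ.≤ c i → InX 3≤k z π → ¬ InInterval z i j π
  X-disjoint-interval (R , _) i j 2≤i i≤k∸1 j≤c (inj₁ singleton) I = interval-z₁₀-notSingleton R 2≤i i≤k∸1 j≤c I singleton
  X-disjoint-interval (R , _) i j 2≤i i≤k∸1 _   (inj₂ z₁₀∼zₖ)  I = interval-z₁₀≁zₖ R 2≤i i≤k∸1 I z₁₀∼zₖ

  intervals-disjoint : ∀ (π : NCP) i j i′ j′ →
    2 ℕ.≤ i → i ℕ.≤ k ∸ 1 → j ℕ.≤ c i → 2 ℕ.≤ i′ → i′ ℕ.≤ k ∸ 1 → j′ ℕ.≤ c i′ →
    InInterval z i j π → InInterval z i′ j′ π → i ≡ i′ × j ≡ j′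
  intervals-disjoint (R , _) _ _ _ _ = interval-unique R

module Isomorphism (F : OrderedField) (k : ℕ) (c : ℕ → ℕ)
  (z : ℕ → ℕ → Geometry.Point F) (t : ℕ → ℕ → OrderedField.Carrier F)
  (3≤k : 3 ℕ.≤ k) (c₁≡0 : c 1 ≡ 0)
  (convex : Geometry.ConvexCCW F k z) (onSides : Geometry.SidePoints F k c z t) where

  open Separation F k c z t 3≤k c₁≡0 convex onSides
  open Intervals F k c z t 3≤k c₁≡0 convex onSides using (NCP)

  Lab′ : Set
  Lab′ = Label′ k c

  pt′ : Lab′ → Point
  pt′ l = pt (proj₁ l)

  NCP′ : Set
  NCP′ = NC Lab′ pt′

  zₖ′ : Lab′
  zₖ′ = zₖ , zₖ-not10

  restrict : NCP → NCP′
  restrict (R , R-nc) = pullback proj₁ R , λ a b a≁b (x , x∈a , x∈b) →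
    R-nc (proj₁ a) (proj₁ b) a≁b (x , ∈Conv-mono (forget a) x∈a , ∈Conv-mono (forget b) x∈b)
    where
    forget : ∀ (a : Lab′) y → block pt′ (pullback proj₁ R) a y → block pt R (proj₁ a) y
    forget a y ((l , _) , a∼l , y≈l) = l , a∼l , y≈l

  -- The extension of σ by o sends z₁₀ to o (just zₖ′: into the block of zₖ; nothing: a new
  -- singleton) and every other label to itself.
  embed : Maybe Lab′ → Lab → Maybe Lab′
  embed o l with is10? l
  ... | yes _    = o
  ... | no l≢z₁₀ = just (l , l≢z₁₀)

  embed-cases : ∀ o l → (Is10 l × embed o l ≡ o) ⊎ (Σ (¬ Is10 l) λ n → embed o l ≡ just (l , n))
  embed-cases o l with is10? l
  ... | yes l≡z₁₀ = inj₁ (l≡z₁₀ , ≡.refl)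
  ... | no n      = inj₂ (n , ≡.refl)

  embed-z₁₀ : ∀ o → embed o z₁₀ ≡ o
  embed-z₁₀ o with embed-cases o z₁₀
  ... | inj₁ (_ , z₁₀↦o)  = z₁₀↦o
  ... | inj₂ (z₁₀≢z₁₀ , _) = ⊥-elim (z₁₀≢z₁₀ z₁₀-is10)

  embed-other : ∀ o {l} → ¬ Is10 l → ∃ λ n → embed o l ≡ just (l , n)
  embed-other o {l} l≢z₁₀ with embed-cases o l
  ... | inj₁ (l≡z₁₀ , _) = ⊥-elim (l≢z₁₀ l≡z₁₀)
  ... | inj₂ l↦l         = l↦l

  module Extension (σ : NCP′) where

    private
      S : Lab′ → Lab′ → Bool
      S = rel (proj₁ σ)

    σ⁺ : Partition (Maybe Lab′)
    σ⁺ = adjoinSingleton (proj₁ σ)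

    rel⁺ : Maybe Lab′ → Maybe Lab′ → Bool
    rel⁺ = rel σ⁺

    InBlock : Lab′ → Lab → Set
    InBlock a l = Σ (¬ Is10 l) λ n → S a (l , n) ≡ true

    σ-apart : ∀ {a b} → S a b ≡ false → ∀ x → x ∈Conv Points (InBlock a) → x ∈Conv Points (InBlock b) → ⊥
    σ-apart {a} {b} a≁b x x∈a x∈b = proj₂ σ a b a≁b (x , ∈Conv-mono (toBlock a) x∈a , ∈Conv-mono (toBlock b) x∈b)
      where
      toBlock : ∀ a y → Points (InBlock a) y → block pt′ (proj₁ σ) a y
      toBlock a y (l , (n , a∼l) , y≈l) = (l , n) , a∼l , y≈l

    -- Two proofs that l is not z₁₀ give the same point, so noncrossing forces them into one block.
    copies-related : ∀ l n n′ → S (l , n) (l , n′) ≡ true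
    copies-related l n n′ with S (l , n) (l , n′) Bool.≟ true
    ... | yes related = related
    ... | no unrelated = ⊥-elim (σ-apart (Bool.¬-not unrelated) (pt l)
          (∈⇒∈Conv {Points (InBlock (l , n))} (l , (n , rel-refl (proj₁ σ) (l , n)) , ≈ₚ-refl))
          (∈⇒∈Conv {Points (InBlock (l , n′))} (l , (n′ , rel-refl (proj₁ σ) (l , n′)) , ≈ₚ-refl)))

    rel-irrelevant : ∀ {l l′} n n′ m m′ → S (l , n) (l′ , n′) ≡ S (l , m) (l′ , m′)
    rel-irrelevant {l} {l′} n n′ m m′ = Bool.⇔→≡ {z = true} (mk⇔ (move n n′ m m′) (move m m′ n n′))
      where
      move : ∀ n n′ m m′ → S (l , n) (l′ , n′) ≡ true → S (l , m) (l′ , m′) ≡ true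
      move n n′ m m′ e = rel-trans (proj₁ σ) (l , m) (l , n) (l′ , m′) (copies-related l m n)
                           (rel-trans (proj₁ σ) (l , n) (l′ , n′) (l′ , m′) e (copies-related l′ n′ m′))

    retag : ∀ a {l} n n′ → S a (l , n) ≡ true → S a (l , n′) ≡ true
    retag (a , m) n n′ a∼l = ≡.trans (rel-irrelevant m n′ m n) a∼l

    InBlock? : ∀ a l → Dec (InBlock a l)
    InBlock? a l with is10? l
    ... | yes l≡z₁₀ = no λ l∈a → proj₁ l∈a l≡z₁₀
    ... | no n with S a (l , n) Bool.≟ true
    ...   | yes a∼l = yes (n , a∼l)
    ...   | no a≁l  = no λ { (n′ , a∼l) → a≁l (retag a n′ n a∼l) }

    ExtRel : Maybe Lab′ → Partition Lab
    ExtRel o = pullback (embed o) σ⁺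

    module _ (o : Maybe Lab′) where

      Block : Lab → Point → Set
      Block = block pt (ExtRel o)

      block-just : ∀ {a c} → embed o a ≡ just c → ∀ y → Block a y →
        Points (InBlock c) y ⊎ ((y ≈ₚ pt z₁₀) × (rel⁺ (just c) o ≡ true))
      block-just {a} {c} a↦c y (l , a∼l , y≈l) with embed-cases o l
      ... | inj₁ (l≡z₁₀ , l↦o) =
        inj₂ (≡.subst (λ l → y ≈ₚ pt l) (Is10⇒≡z₁₀ {l} l≡z₁₀) y≈l ,
              ≡.subst₂ (λ u v → rel⁺ u v ≡ true) a↦c l↦o a∼l)
      ... | inj₂ (n , l↦l) = inj₁ (l , (n , ≡.subst₂ (λ u v → rel⁺ u v ≡ true) a↦c l↦l a∼l) , y≈l)

      block-nothing : ∀ {a} → embed o a ≡ nothing → ∀ y → Block a y → y ≈ₚ pt z₁₀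
      block-nothing {a} a↦nothing y (l , a∼l , y≈l) with embed-cases o l
      ... | inj₁ (l≡z₁₀ , _) = ≡.subst (λ l → y ≈ₚ pt l) (Is10⇒≡z₁₀ {l} l≡z₁₀) y≈l
      ... | inj₂ (n , l↦l) with ≡.subst₂ (λ u v → rel⁺ u v ≡ true) a↦nothing l↦l a∼l
      ...   | ()

    private
      only-σ : ∀ {o b c} → embed o b ≡ just c → ¬ (rel⁺ (just c) o ≡ true) → ∀ y → Block o b y → Points (InBlock c) y
      only-σ {o} b↦c c≁o y y∈ with block-just o b↦c y y∈
      ... | inj₁ y∈c       = y∈c
      ... | inj₂ (_ , c∼o) = ⊥-elim (c≁o c∼o)

      unrelated : ∀ {o a a′ u u′} → rel (ExtRel o) a a′ ≡ false → embed o a ≡ u → embed o a′ ≡ u′ → rel⁺ u u′ ≡ false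
      unrelated a≁a′ a↦ a′↦ = ≡.subst₂ (λ u v → rel⁺ u v ≡ false) a↦ a′↦ a≁a′

    extension-nonCrossing₀ : NonCrossing pt (ExtRel nothing)
    extension-nonCrossing₀ a a′ a≁a′ (x , x∈a , x∈a′) = cases (embed nothing a) (embed nothing a′) ≡.refl ≡.refl
      where
      cases : ∀ u u′ → embed nothing a ≡ u → embed nothing a′ ≡ u′ → ⊥
      cases nothing  nothing   a↦ a′↦ = ≡false⇒≢true (unrelated {nothing} a≁a′ a↦ a′↦) ≡.refl
      cases nothing  (just c′) a↦ a′↦ =
        z₁₀-apart (λ _ → proj₁) x (∈Conv-mono (block-nothing nothing a↦) x∈a) (∈Conv-mono (only-σ {nothing} a′↦ λ ()) x∈a′)
      cases (just c) nothing   a↦ a′↦ =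
        z₁₀-apart (λ _ → proj₁) x (∈Conv-mono (block-nothing nothing a′↦) x∈a′) (∈Conv-mono (only-σ {nothing} a↦ λ ()) x∈a)
      cases (just c) (just c′) a↦ a′↦ =
        σ-apart (unrelated {nothing} a≁a′ a↦ a′↦) x
          (∈Conv-mono (only-σ {nothing} a↦ λ ()) x∈a) (∈Conv-mono (only-σ {nothing} a′↦ λ ()) x∈a′)

    private
      embedₖ-just : ∀ a → embed (just zₖ′) a ≢ nothing
      embedₖ-just a a↦nothing with embed-cases (just zₖ′) a
      ... | inj₁ (_ , a↦zₖ) with ≡.trans (≡.sym a↦zₖ) a↦nothing
      ...   | ()
      embedₖ-just a a↦nothing | inj₂ (_ , a↦a) with ≡.trans (≡.sym a↦a) a↦nothing
      ...   | ()

      adjoined-apart : ∀ {a a′ c c′} → embed (just zₖ′) a ≡ just c → embed (just zₖ′) a′ ≡ just c′ →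
        S c c′ ≡ false → S c zₖ′ ≡ true → ∀ x → x ∈Conv Block (just zₖ′) a → x ∈Conv Block (just zₖ′) a′ → ⊥
      adjoined-apart {a} {a′} {c} {c′} a↦c a′↦c′ c≁c′ c∼zₖ x x∈a x∈a′ =
        AdjoinZ₁₀.still-apart (InBlock zₖ′) (InBlock c′) (InBlock? zₖ′) (InBlock? c′) (λ _ → proj₁) (λ _ → proj₁)
          B∩C=∅ (zₖ-not10 , rel-refl (proj₁ σ) zₖ′) (proj₂ c′ , rel-refl (proj₁ σ) c′) (σ-apart zₖ≁c′)
          x (∈Conv-mono into-adjoined x∈a) (∈Conv-mono (only-σ a′↦c′ c′≁zₖ) x∈a′)
        where
        c′≁zₖ : ¬ (S c′ zₖ′ ≡ true)
        c′≁zₖ c′∼zₖ =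
          ≡false⇒≢true c≁c′ (rel-trans (proj₁ σ) c zₖ′ c′ c∼zₖ (rel-sym (proj₁ σ) c′ zₖ′ c′∼zₖ))
        zₖ≁c′ : S zₖ′ c′ ≡ false
        zₖ≁c′ = Bool.¬-not λ zₖ∼c′ → c′≁zₖ (rel-sym (proj₁ σ) zₖ′ c′ zₖ∼c′)
        B∩C=∅ : ∀ l → InBlock zₖ′ l → InBlock c′ l → ⊥
        B∩C=∅ l (n , zₖ∼l) (n′ , c′∼l) =
          ≡false⇒≢true zₖ≁c′
            (rel-trans (proj₁ σ) zₖ′ (l , n) c′ zₖ∼l (rel-sym (proj₁ σ) c′ (l , n) (retag c′ n′ n c′∼l)))
        into-adjoined : ∀ y → Block (just zₖ′) a y → WithZ₁₀ (InBlock zₖ′) y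
        into-adjoined y y∈ with block-just (just zₖ′) a↦c y y∈
        ... | inj₁ (l , (n , c∼l) , y≈l) =
          inj₂ (l , (n , rel-trans (proj₁ σ) zₖ′ c (l , n) (rel-sym (proj₁ σ) c zₖ′ c∼zₖ) c∼l) , y≈l)
        ... | inj₂ (y≈z₁₀ , _) = inj₁ y≈z₁₀

    extension-nonCrossingₖ : NonCrossing pt (ExtRel (just zₖ′))
    extension-nonCrossingₖ a a′ a≁a′ (x , x∈a , x∈a′) = cases (embed (just zₖ′) a) (embed (just zₖ′) a′) ≡.refl ≡.refl
      where
      cases : ∀ u u′ → embed (just zₖ′) a ≡ u → embed (just zₖ′) a′ ≡ u′ → ⊥
      cases nothing  _         a↦ _   = embedₖ-just a a↦
      cases (just _) nothing   _  a′↦ = embedₖ-just a′ a′↦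
      cases (just c) (just c′) a↦ a′↦ with S c zₖ′ Bool.≟ true | S c′ zₖ′ Bool.≟ true
      ... | yes c∼zₖ | _          = adjoined-apart a↦ a′↦ (unrelated {just zₖ′} a≁a′ a↦ a′↦) c∼zₖ x x∈a x∈a′
      ... | no _     | yes c′∼zₖ  =
        adjoined-apart a′↦ a↦ (≡false-sym (proj₁ σ) c c′ (unrelated {just zₖ′} a≁a′ a↦ a′↦)) c′∼zₖ x x∈a′ x∈a
      ... | no c≁zₖ  | no c′≁zₖ   =
        σ-apart (unrelated {just zₖ′} a≁a′ a↦ a′↦) x
          (∈Conv-mono (only-σ a↦ c≁zₖ) x∈a) (∈Conv-mono (only-σ a′↦ c′≁zₖ) x∈a′)

    z₁₀-image : Bool → Maybe Lab′
    z₁₀-image true  = just zₖ′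
    z₁₀-image false = nothing

    extension-nonCrossing : ∀ b → NonCrossing pt (ExtRel (z₁₀-image b))
    extension-nonCrossing true  = extension-nonCrossingₖ
    extension-nonCrossing false = extension-nonCrossing₀

    extension : Bool → NCP
    extension b = ExtRel (z₁₀-image b) , extension-nonCrossing b

    extension-z₁₀∼zₖ : ∀ b → rel (proj₁ (extension b)) z₁₀ zₖ ≡ b
    extension-z₁₀∼zₖ b with embed-other (z₁₀-image b) zₖ-not10
    ... | n , zₖ↦zₖ = ≡.trans (≡.cong₂ rel⁺ (embed-z₁₀ (z₁₀-image b)) zₖ↦zₖ) (image-rel b)
      where
      image-rel : ∀ b → rel⁺ (z₁₀-image b) (just (zₖ , n)) ≡ b
      image-rel true  = retag zₖ′ zₖ-not10 n (rel-refl (proj₁ σ) zₖ′)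
      image-rel false = ≡.refl

    extension-restrict : ∀ b a a′ → rel (proj₁ (restrict (extension b))) a a′ ≡ S a a′
    extension-restrict b (l , n) (l′ , n′) with embed-other (z₁₀-image b) n | embed-other (z₁₀-image b) n′
    ... | m , l↦l | m′ , l′↦l′ =
      ≡.trans (≡.cong₂ rel⁺ l↦l l′↦l′) (rel-irrelevant m m′ n n′)

    extension-inX : ∀ b → InX 3≤k z (extension b)
    extension-inX true  = inj₂ (extension-z₁₀∼zₖ true)
    extension-inX false = inj₁ singleton
      where
      singleton : ∀ l → rel (proj₁ (extension false)) z₁₀ l ≡ true → Is10 l
      singleton l z₁₀∼l with embed-cases nothing l
      ... | inj₁ (l≡z₁₀ , _) = l≡z₁₀
      ... | inj₂ (_ , l↦l) with ≡.trans (≡.sym (≡.cong₂ rel⁺ (embed-z₁₀ nothing) l↦l)) z₁₀∼l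
      ...   | ()

  X : Set
  X = Σ NCP (InX 3≤k z)

  toProduct : X → NCP′ × Bool
  toProduct (π , _) = restrict π , rel (proj₁ π) z₁₀ zₖ

  _≤X_ : X → X → Set
  x ≤X x′ = proj₁ x ≤NC proj₁ x′

  _≤×_ : NCP′ × Bool → NCP′ × Bool → Set
  p ≤× p′ = (proj₁ p ≤NC proj₁ p′) × (proj₂ p ≤ᴮ proj₂ p′)

  toProduct-mono : ∀ x x′ → x ≤X x′ → toProduct x ≤× toProduct x′
  toProduct-mono _ _ R⊑R′ = (λ a a′ → R⊑R′ (proj₁ a) (proj₁ a′)) , ≤ᴮ-intro (R⊑R′ z₁₀ zₖ)

  -- z₁₀ is either alone or joined to zₖ, so its block is recovered from the rest and the bit.
  z₁₀-joined : ∀ x x′ → toProduct x ≤× toProduct x′ →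
    ∀ m → ¬ Is10 m → rel (proj₁ (proj₁ x)) z₁₀ m ≡ true → rel (proj₁ (proj₁ x′)) z₁₀ m ≡ true
  z₁₀-joined (π , inj₁ singleton) _ _ m m≢z₁₀ z₁₀∼m = ⊥-elim (m≢z₁₀ (singleton m z₁₀∼m))
  z₁₀-joined ((R , _) , inj₂ z₁₀∼zₖ) ((R′ , _) , _) (R⊑R′ , b≤b′) m m≢z₁₀ z₁₀∼m =
    rel-trans R′ z₁₀ zₖ m (≤ᴮ-elim b≤b′ z₁₀∼zₖ)
      (R⊑R′ zₖ′ (m , m≢z₁₀) (rel-trans R zₖ z₁₀ m (rel-sym R z₁₀ zₖ z₁₀∼zₖ) z₁₀∼m))

  toProduct-reflects : ∀ x x′ → toProduct x ≤× toProduct x′ → x ≤X x′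
  toProduct-reflects x@((R , _) , _) x′@((R′ , _) , _) x≤x′ l l′ l∼l′ with is10? l | is10? l′
  ... | yes l≡z₁₀ | yes l′≡z₁₀ =
    ≡.subst₂ (λ u v → rel R′ u v ≡ true) (≡.sym (Is10⇒≡z₁₀ {l} l≡z₁₀)) (≡.sym (Is10⇒≡z₁₀ {l′} l′≡z₁₀))
      (rel-refl R′ z₁₀)
  ... | yes l≡z₁₀ | no l′≢z₁₀ =
    ≡.subst (λ u → rel R′ u l′ ≡ true) (≡.sym (Is10⇒≡z₁₀ {l} l≡z₁₀))
      (z₁₀-joined x x′ x≤x′ l′ l′≢z₁₀ (≡.subst (λ u → rel R u l′ ≡ true) (Is10⇒≡z₁₀ {l} l≡z₁₀) l∼l′))
  ... | no l≢z₁₀ | yes l′≡z₁₀ =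
    rel-sym R′ l′ l (≡.subst (λ u → rel R′ u l ≡ true) (≡.sym (Is10⇒≡z₁₀ {l′} l′≡z₁₀))
      (z₁₀-joined x x′ x≤x′ l l≢z₁₀
        (≡.subst (λ u → rel R u l ≡ true) (Is10⇒≡z₁₀ {l′} l′≡z₁₀) (rel-sym R l l′ l∼l′))))
  ... | no l≢z₁₀ | no l′≢z₁₀ = proj₁ x≤x′ (l , l≢z₁₀) (l′ , l′≢z₁₀) l∼l′

  toProduct-onto : ∀ p → ∃ λ x → (toProduct x ≤× p) × (p ≤× toProduct x)
  toProduct-onto (σ , b) =
    (extension b , extension-inX b) ,
    ((λ a a′ e → ≡.trans (≡.sym (extension-restrict b a a′)) e) , ≡.subst (_≤ᴮ b) (≡.sym (extension-z₁₀∼zₖ b)) b≤b) ,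
    ((λ a a′ e → ≡.trans (extension-restrict b a a′) e) , ≡.subst (b ≤ᴮ_) (≡.sym (extension-z₁₀∼zₖ b)) b≤b)
    where open Extension σ

  X≅NCP′×Bool : OrderIso X (NCP′ × Bool) _≤X_ _≤×_
  X≅NCP′×Bool = toProduct , (λ x x′ → toProduct-mono x x′ , toProduct-reflects x x′) , toProduct-onto

lemma2p6 : (F : OrderedField) (k : ℕ) (c : ℕ → ℕ)
  (z : ℕ → ℕ → Geometry.Point F) (t : ℕ → ℕ → OrderedField.Carrier F) →
  (h : 3 ≤ k) → c 1 ≡ 0 →
  Geometry.ConvexCCW F k z → Geometry.SidePoints F k c z t →
  let open Geometry F
      NCP = NC (Label k c) (labelPoint z)
      NCP′ = NC (Label′ k c) (λ l → labelPoint z (proj₁ l))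
  in OrderIso (Σ NCP (InX h z)) (NCP′ × Bool)
       (λ x y → proj₁ x ≤NC proj₁ y)
       (λ x y → (proj₁ x ≤NC proj₁ y) × (proj₂ x ≤ᴮ proj₂ y))
     × (∀ (π : NCP) → InX h z π ⊎
          ∃₂ λ i j → (2 ≤ i × i ≤ k ∸ 1 × j ≤ c i) × InInterval z i j π)
     × (∀ (π : NCP) i j → 2 ≤ i → i ≤ k ∸ 1 → j ≤ c i →
          InX h z π → ¬ InInterval z i j π)
     × (∀ (π : NCP) i j i′ j′ →
          2 ≤ i → i ≤ k ∸ 1 → j ≤ c i → 2 ≤ i′ → i′ ≤ k ∸ 1 → j′ ≤ c i′ →
          InInterval z i j π → InInterval z i′ j′ π → i ≡ i′ × j ≡ j′)
lemma2p6 F k c z t 3≤k c₁≡0 convex onSides =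
  X≅NCP′×Bool , X-or-interval , X-disjoint-interval , intervals-disjoint
  where
  open Intervals F k c z t 3≤k c₁≡0 convex onSides
  open Isomorphism F k c z t 3≤k c₁≡0 convex onSides
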